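{- For every integer $k\ge 2$ and every integer $n\ge 1$, in the hat game with $n$ prisoners and $k$ extra hats there is a deterministic strategy whose success probability is at least $\frac{1}{e\,k^2}$.
   Context: Hat game with $n$ prisoners and $k$ extra hats: prisoners numbered $1,\dots,n$ stand in a line; there are $n+k$ hats with distinct colors $1,\dots,n+k$. The warden assigns a uniformly random injective map $\{1,\dots,n\}\to\{1,\dots,n+k\}$ (prisoner $i$ gets color $x_i$; unused hats are discarded). Prisoner $i$ sees exactly $x_{i+1},\dots,x_n$. Prisoners guess their own colors in the order $1,\dots,n$, each hearing all earlier guesses; a deterministic strategy specifies each prisoner's guess as a function of what he sees and hears, agreed in advance. They win if all guesses are correct; the success probability is the fraction of the $(n+k)!/k!$ assignments on which they win. -}

module Defs where

open import Data.Nat using (ℕ; zero; suc; _+_; _*_; _!; _/_)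
open import Data.Nat.Properties using (_!≢0)
open import Data.Fin using (Fin)
import Data.Fin.Properties as FinP
open import Data.Bool using (Bool; true; false; _∧_)
open import Data.List using (List; []; _∷_; [_]; _++_; map; concatMap; filter; length; allFin; zip; upTo)
open import Data.Nat.ListAction using (sum)
open import Data.Vec using (Vec; toList)
import Data.Vec as Vec
open import Data.Product using (_×_; _,_; proj₂)
open import Relation.Nullary.Decidable using (⌊_⌋)
import Data.List.Relation.Unary.Unique.DecPropositional as UniqueDec

-- Colours are Fin m (with m = n + k); prisoners are Fin n.

boolFilter : ∀ {A : Set} → (A → Bool) → List A → List A
boolFilter p []       = []
boolFilter p (x ∷ xs) with p x
... | true  = x ∷ boolFilter p xs
... | false = boolFilter p xs

allVecs : (m n : ℕ) → List (Vec (Fin m) n)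
allVecs m zero    = Vec.[] ∷ []
allVecs m (suc n) = concatMap (λ c → map (c Vec.∷_) (allVecs m n)) (allFin m)

injective? : ∀ {m n} → Vec (Fin m) n → Bool
injective? {m} x = ⌊ UniqueDec.unique? FinP._≟_ (toList x) ⌋

assignments : (n k : ℕ) → List (Vec (Fin (n + k)) n)
assignments n k = boolFilter injective? (allVecs (n + k) n)

-- A deterministic strategy: prisoner i, given the list of guesses he has
-- heard (those of prisoners 1..i-1, in order) and the list of colours he
-- sees (x_{i+1},…,x_n, in order), announces a colour.
Strategy : (n m : ℕ) → Set
Strategy n m = Fin n → List (Fin m) → List (Fin m) → Fin m

run : ∀ {n m} → Strategy n m → List (Fin n × Fin m) → List (Fin m) → Bool
run s []             heard = true
run s ((i , c) ∷ rest) heard =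
  let g = s i heard (map proj₂ rest)
  in ⌊ g FinP.≟ c ⌋ ∧ run s rest (heard ++ [ g ])

wins? : ∀ {n m} → Strategy n m → Vec (Fin m) n → Bool
wins? {n} s x = run s (zip (allFin n) (toList x)) []

winCount : (n k : ℕ) → Strategy n (n + k) → ℕ
winCount n k s = length (boolFilter (wins? s) (assignments n k))

totalCount : (n k : ℕ) → ℕ
totalCount n k = length (assignments n k)

-- N! · Σ_{j=0}^{N} 1/j!  (an exact natural number), so that the N-th
-- partial sum of e = Σ 1/j! is  eSumScaled N / N!.
eSumScaled : ℕ → ℕ
eSumScaled N = sum (map (λ j → (N ! / j !) {{j !≢0}}) (upTo (suc N)))

-- "wins/total ≥ 1/(e k²)", i.e. total/(k²·wins) ≤ e.  Since e is irrational
-- and the left side is rational, this is equivalent to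
-- total/(k²·wins) < e, i.e. to being strictly below some partial sum of
-- Σ 1/j!:  total · N! < k² · wins · (N! Σ_{j≤N} 1/j!).
SuccessAtLeastOneOverEK² : (n k : ℕ) → Strategy n (n + k) → Set
SuccessAtLeastOneOverEK² n k s =
  Data.Product.Σ ℕ λ N → totalCount n k * (N !) Data.Nat.< (k * k) * winCount n k s * eSumScaled N

{-# OPTIONS --safe #-}

-- A strategy is given by a labelling f of the n + k colours by Fin m, a residue r
-- and a parity ε.  A prisoner guesses the first colour c, neither seen nor heard,
-- such that the labels of all colours neither seen nor heard sum to r + f c
-- modulo m and the arrangement with c put in his place has signature ε.  If r is
-- the label sum of the k unused hats, ε is the signature of the true arrangement
-- and f is injective on the unused hats, his own colour is the only candidate:
-- another candidate c′ is unused and has the label of c, so every colour strictly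
-- between them in the order by (label, colour) is in the line, and then putting
-- c′ in place of c flips the signature (inversions plus ranks, mod 2).
-- Averaging over all (f, r, ε), some strategy wins on at least the fraction
-- m(m − 1)⋯(m − k + 1) / (2m · m^k) of the assignments.  For k ≥ 9 and
-- m = k(k − 1)/2 this beats 1/(e k²) by (1 + 1/m)^m ≤ ∑_{j ≤ m} 1/j! and a
-- Weierstrass product bound for the falling factorial; for k ≤ 8 suitable m and
-- partial sums of e are checked by evaluation.

module Submission where

open import Defs

open import Data.Nat hiding (_≟_)
import Data.Nat as ℕ
open import Data.Nat.Properties hiding (_≟_)
open import Data.Nat.DivMod using (_%_; _/_; m≡m%n+[m/n]*n; [m+kn]%n≡m%n; m<n⇒m%n≡m; m%n<n; m/n*n≡m; m*n/n≡m)
open import Data.Nat.Combinatorics using (_C_; k![n∸k]!∣n!)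
open import Data.Nat.Combinatorics.Specification using (nCk≡n!/k![n-k]!)
open import Data.Nat.Combinatorics.Base using (_P′_)
open import Data.Nat.Solver using (module +-*-Solver)
open import Data.Bool using (Bool; true; false; not; _∧_; _∨_)
open import Data.Bool.Properties using (∧-zeroʳ; ∧-identityʳ)
open import Data.Fin as Fin using (Fin; zero; suc; toℕ)
open import Data.Fin.Properties using (_≟_; toℕ-injective; toℕ<n; remQuot-combine; combine-monoˡ-<)
import Data.Fin.Properties as Fin
open import Data.List using (List; []; _∷_; [_]; _++_; map; concatMap; length; allFin; tabulate; zip; upTo; applyUpTo)
open import Data.Nat.ListAction using (sum)
open import Data.List.Properties using (++-assoc; length-tabulate; length-++; length-map; length-upTo)
open import Data.Vec using (Vec; lookup; toList) renaming ([] to []ᵛ; _∷_ to _∷ᵛ_)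
open import Data.Vec.Properties using (length-toList)
import Data.Vec as Vec
open import Data.List.Membership.Propositional using (_∈_; _∉_; lose)
open import Data.List.Membership.Propositional.Properties
  using (∈-++⁺ˡ; ∈-++⁺ʳ; ∈-++⁻; ∈-insert; ∈-allFin; ∈-map⁺; ∈-concatMap⁺; ∈-upTo⁺)
open import Data.List.Relation.Unary.Any using (here; there)
open import Data.List.Relation.Unary.All using ([]; _∷_)
open import Data.List.Relation.Unary.All.Properties using (All¬⇒¬Any; ++⁺; ++⁻)
open import Data.List.Relation.Unary.AllPairs using ([]; _∷_)
open import Data.List.Relation.Unary.Unique.Propositional using (Unique)
import Data.List.Relation.Unary.Unique.Propositional.Properties as Unique
import Data.List.Relation.Unary.Unique.DecPropositional as UniqueDec
open import Data.Parity using (Parity; 0ℙ; 1ℙ; _⁻¹) renaming (_+_ to _+ℙ_)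
import Data.Parity.Properties as ℙ
open import Data.Product using (Σ; _×_; _,_; proj₁; proj₂)
open import Data.Sum using (_⊎_; inj₁; inj₂; [_,_]′)
open import Function using (_∘_; case_of_)
open import Relation.Binary using (tri<; tri≈; tri>)
open import Relation.Binary.PropositionalEquality hiding ([_])
open import Relation.Nullary using (Dec; yes; no; does; contradiction)
open import Relation.Nullary.Decidable using (dec-true; dec-false; _×-dec_; isYes≗does; toWitness)

open import Algebra.Properties.CommutativeSemigroup +-commutativeSemigroup
  using () renaming (interchange to +-interchange; x∙yz≈y∙xz to x+[y+z]≡y+[x+z])
open import Algebra.Properties.CommutativeSemigroup *-commutativeSemigroup
  using () renaming ( interchange to *-interchange; x∙yz≈y∙xz to x*[y*z]≡y*[x*z]
                    ; x∙yz≈xz∙y to x*[y*z]≡x*z*y; xy∙z≈y∙xz to x*y*z≡y*[x*z] )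
open +-*-Solver using (solve; _:+_; _:*_; _:=_; con)

-- Finite sums

𝟙 : Bool → ℕ
𝟙 true  = 1
𝟙 false = 0

from-does : ∀ {P : Set} (d : Dec P) → does d ≡ true → P
from-does (yes p) _ = p

𝟙-∧ : ∀ a b → 𝟙 (a ∧ b) ≡ 𝟙 a * 𝟙 b
𝟙-∧ true  b = sym (*-identityˡ (𝟙 b))
𝟙-∧ false b = refl

𝟙-∨ : ∀ a b → 𝟙 (a ∨ b) ≤ 𝟙 a + 𝟙 b
𝟙-∨ true  b = s≤s z≤n
𝟙-∨ false b = ≤-refl

𝟙-not : ∀ b → 𝟙 (not b) + 𝟙 b ≡ 1
𝟙-not true  = refl
𝟙-not false = refl

∧≡true⇒ : ∀ {x y} → x ∧ y ≡ true → x ≡ true × y ≡ true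
∧≡true⇒ {true} e = refl , e

∨≡false⇒ : ∀ {x y} → x ∨ y ≡ false → x ≡ false × y ≡ false
∨≡false⇒ {false} e = refl , e

∑ : (n : ℕ) → (Fin n → ℕ) → ℕ
∑ zero    g = 0
∑ (suc n) g = g zero + ∑ n (g ∘ suc)

syntax ∑ n (λ i → e) = ∑[ i < n ] e

∑ˡ : {A : Set} → List A → (A → ℕ) → ℕ
∑ˡ []       g = 0
∑ˡ (x ∷ xs) g = g x + ∑ˡ xs g

syntax ∑ˡ xs (λ x → e) = ∑[ x ∈ xs ] e

∑-cong : ∀ n {g h : Fin n → ℕ} → (∀ i → g i ≡ h i) → ∑ n g ≡ ∑ n h
∑-cong zero    e = refl
∑-cong (suc n) e = cong₂ _+_ (e zero) (∑-cong n (e ∘ suc))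

∑-mono-≤ : ∀ n {g h : Fin n → ℕ} → (∀ i → g i ≤ h i) → ∑ n g ≤ ∑ n h
∑-mono-≤ zero    e = z≤n
∑-mono-≤ (suc n) e = +-mono-≤ (e zero) (∑-mono-≤ n (e ∘ suc))

∑-distrib-+ : ∀ n (g h : Fin n → ℕ) → ∑[ i < n ] (g i + h i) ≡ ∑ n g + ∑ n h
∑-distrib-+ zero    g h = refl
∑-distrib-+ (suc n) g h = begin
  g zero + h zero + ∑[ i < n ] (g (suc i) + h (suc i))
    ≡⟨ cong (g zero + h zero +_) (∑-distrib-+ n (g ∘ suc) (h ∘ suc)) ⟩
  g zero + h zero + (∑ n (g ∘ suc) + ∑ n (h ∘ suc))
    ≡⟨ +-interchange (g zero) (h zero) _ _ ⟩
  g zero + ∑ n (g ∘ suc) + (h zero + ∑ n (h ∘ suc)) ∎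
  where open ≡-Reasoning

*-distribˡ-∑ : ∀ n c (g : Fin n → ℕ) → c * ∑ n g ≡ ∑[ i < n ] (c * g i)
*-distribˡ-∑ zero    c g = *-zeroʳ c
*-distribˡ-∑ (suc n) c g =
  trans (*-distribˡ-+ c (g zero) _) (cong (c * g zero +_) (*-distribˡ-∑ n c (g ∘ suc)))

*-distribʳ-∑ : ∀ n c (g : Fin n → ℕ) → ∑ n g * c ≡ ∑[ i < n ] (g i * c)
*-distribʳ-∑ n c g =
  trans (*-comm (∑ n g) c) (trans (*-distribˡ-∑ n c g) (∑-cong n λ i → *-comm c (g i)))

∑-const : ∀ n c → ∑[ i < n ] c ≡ n * c
∑-const zero    c = refl
∑-const (suc n) c = cong (c +_) (∑-const n c)

∑-pick : ∀ n (a : Fin n) (g : Fin n → ℕ) → ∑[ i < n ] (𝟙 (does (i ≟ a)) * g i) ≡ g a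
∑-pick (suc n) zero    g = begin
  1 * g zero + ∑[ i < n ] 0  ≡⟨ cong₂ _+_ (*-identityˡ (g zero)) (trans (∑-const n 0) (*-zeroʳ n)) ⟩
  g zero + 0                 ≡⟨ +-identityʳ (g zero) ⟩
  g zero                     ∎
  where open ≡-Reasoning
∑-pick (suc n) (suc a) g = ∑-pick n a (g ∘ suc)

module _ {A : Set} where

  ∑ˡ-cong : ∀ (xs : List A) {g h : A → ℕ} → (∀ x → g x ≡ h x) → ∑ˡ xs g ≡ ∑ˡ xs h
  ∑ˡ-cong []       e = refl
  ∑ˡ-cong (x ∷ xs) e = cong₂ _+_ (e x) (∑ˡ-cong xs e)

  ∑ˡ-mono-≤ : ∀ (xs : List A) {g h : A → ℕ} → (∀ x → g x ≤ h x) → ∑ˡ xs g ≤ ∑ˡ xs h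
  ∑ˡ-mono-≤ []       e = z≤n
  ∑ˡ-mono-≤ (x ∷ xs) e = +-mono-≤ (e x) (∑ˡ-mono-≤ xs e)

  ∑ˡ-++ : ∀ (xs ys : List A) g → ∑ˡ (xs ++ ys) g ≡ ∑ˡ xs g + ∑ˡ ys g
  ∑ˡ-++ []       ys g = refl
  ∑ˡ-++ (x ∷ xs) ys g = trans (cong (g x +_) (∑ˡ-++ xs ys g)) (sym (+-assoc (g x) _ _))

  ∑ˡ-distrib-+ : ∀ (xs : List A) g h → ∑[ x ∈ xs ] (g x + h x) ≡ ∑ˡ xs g + ∑ˡ xs h
  ∑ˡ-distrib-+ []       g h = refl
  ∑ˡ-distrib-+ (x ∷ xs) g h =
    trans (cong (g x + h x +_) (∑ˡ-distrib-+ xs g h)) (+-interchange (g x) (h x) _ _)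

  *-distribˡ-∑ˡ : ∀ (xs : List A) c g → c * ∑ˡ xs g ≡ ∑[ x ∈ xs ] (c * g x)
  *-distribˡ-∑ˡ []       c g = *-zeroʳ c
  *-distribˡ-∑ˡ (x ∷ xs) c g =
    trans (*-distribˡ-+ c (g x) _) (cong (c * g x +_) (*-distribˡ-∑ˡ xs c g))

  *-distribʳ-∑ˡ : ∀ (xs : List A) c g → ∑ˡ xs g * c ≡ ∑[ x ∈ xs ] (g x * c)
  *-distribʳ-∑ˡ xs c g =
    trans (*-comm (∑ˡ xs g) c) (trans (*-distribˡ-∑ˡ xs c g) (∑ˡ-cong xs λ x → *-comm c (g x)))

  ∑ˡ-const : ∀ (xs : List A) c → ∑[ x ∈ xs ] c ≡ length xs * c
  ∑ˡ-const []       c = refl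
  ∑ˡ-const (x ∷ xs) c = cong (c +_) (∑ˡ-const xs c)

  ∈⇒≤∑ˡ : ∀ {x} (xs : List A) g → x ∈ xs → g x ≤ ∑ˡ xs g
  ∈⇒≤∑ˡ (y ∷ xs) g (here refl) = m≤m+n (g y) _
  ∈⇒≤∑ˡ (y ∷ xs) g (there x∈) = ≤-trans (∈⇒≤∑ˡ xs g x∈) (m≤n+m _ (g y))

  ∃-above-average : ∀ (xs : List A) g → A → Σ A λ a → ∑ˡ xs g ≤ length xs * g a
  ∃-above-average []       g a₀ = a₀ , z≤n
  ∃-above-average (x ∷ xs) g a₀ with ∃-above-average xs g a₀
  ... | a , ≤a with ≤-total (g a) (g x)
  ...   | inj₁ a≤x = x , +-monoʳ-≤ (g x) (≤-trans ≤a (*-monoʳ-≤ (length xs) a≤x))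
  ...   | inj₂ x≤a = a , +-mono-≤ x≤a ≤a

  length-boolFilter : ∀ p (xs : List A) → length (boolFilter p xs) ≡ ∑[ x ∈ xs ] 𝟙 (p x)
  length-boolFilter p []       = refl
  length-boolFilter p (x ∷ xs) with p x
  ... | true  = cong suc (length-boolFilter p xs)
  ... | false = length-boolFilter p xs

  ∑ˡ-boolFilter-mono-≤ : ∀ p (xs : List A) {g h : A → ℕ} → (∀ x → p x ≡ true → g x ≤ h x) →
                         ∑ˡ (boolFilter p xs) g ≤ ∑ˡ (boolFilter p xs) h
  ∑ˡ-boolFilter-mono-≤ p []       e = z≤n
  ∑ˡ-boolFilter-mono-≤ p (x ∷ xs) e with p x in px
  ... | true  = +-mono-≤ (e x px) (∑ˡ-boolFilter-mono-≤ p xs e)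
  ... | false = ∑ˡ-boolFilter-mono-≤ p xs e

module _ {A B : Set} where

  ∑ˡ-map : ∀ (h : A → B) xs g → ∑ˡ (map h xs) g ≡ ∑ˡ xs (g ∘ h)
  ∑ˡ-map h []       g = refl
  ∑ˡ-map h (x ∷ xs) g = cong (g (h x) +_) (∑ˡ-map h xs g)

  ∑ˡ-concatMap : ∀ (h : A → List B) xs g → ∑ˡ (concatMap h xs) g ≡ ∑[ x ∈ xs ] ∑ˡ (h x) g
  ∑ˡ-concatMap h []       g = refl
  ∑ˡ-concatMap h (x ∷ xs) g =
    trans (∑ˡ-++ (h x) (concatMap h xs) g) (cong (∑ˡ (h x) g +_) (∑ˡ-concatMap h xs g))

  ∑ˡ-swap : ∀ (xs : List A) (ys : List B) (g : A → B → ℕ) →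
            ∑[ x ∈ xs ] ∑[ y ∈ ys ] g x y ≡ ∑[ y ∈ ys ] ∑[ x ∈ xs ] g x y
  ∑ˡ-swap []       ys g = sym (trans (∑ˡ-const ys 0) (*-zeroʳ (length ys)))
  ∑ˡ-swap (x ∷ xs) ys g =
    trans (cong (∑ˡ ys (g x) +_) (∑ˡ-swap xs ys g)) (sym (∑ˡ-distrib-+ ys (g x) _))

∑ˡ-allFin : ∀ n g → ∑ˡ (allFin n) g ≡ ∑ n g
∑ˡ-allFin n g = go n (λ i → i)
  where
  go : ∀ {B : Set} n (h : Fin n → B) {g : B → ℕ} → ∑ˡ (tabulate h) g ≡ ∑[ i < n ] g (h i)
  go zero    h = refl
  go (suc n) h {g} = cong (g (h zero) +_) (go n (h ∘ suc))

∑-∑ˡ-swap : ∀ {A : Set} n (xs : List A) (g : Fin n → A → ℕ) →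
            ∑[ i < n ] ∑[ x ∈ xs ] g i x ≡ ∑[ x ∈ xs ] ∑[ i < n ] g i x
∑-∑ˡ-swap n xs g = begin
  ∑[ i < n ] ∑ˡ xs (g i)                 ≡⟨ ∑ˡ-allFin n _ ⟨
  ∑[ i ∈ allFin n ] ∑ˡ xs (g i)          ≡⟨ ∑ˡ-swap (allFin n) xs g ⟩
  ∑[ x ∈ xs ] ∑[ i ∈ allFin n ] g i x    ≡⟨ ∑ˡ-cong xs (λ x → ∑ˡ-allFin n _) ⟩
  ∑[ x ∈ xs ] ∑[ i < n ] g i x           ∎
  where open ≡-Reasoning

length-concatMap : ∀ {A B : Set} (h : A → List B) xs →
                   length (concatMap h xs) ≡ ∑[ x ∈ xs ] length (h x)
length-concatMap h []       = refl
length-concatMap h (x ∷ xs) = trans (length-++ (h x)) (cong (length (h x) +_) (length-concatMap h xs))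

-- Duplicate-free lists of colours

module _ {N : ℕ} where
  open import Data.List.Membership.DecPropositional (_≟_ {N}) public using (_∈?_; _∉?_)

Unique-middle : ∀ {A : Set} (xs : List A) {y} ys →
                Unique (xs ++ y ∷ ys) → y ∉ xs ++ ys × Unique (xs ++ ys)
Unique-middle []       ys (y∉ys ∷ u) = All¬⇒¬Any y∉ys , u
Unique-middle (x ∷ xs) ys (x∉ ∷ u) with Unique-middle xs ys u | ++⁻ xs x∉
... | y∉ , u′ | x∉xs , x≢y ∷ x∉ys = y∉x∷ , ++⁺ x∉xs x∉ys ∷ u′
  where
  y∉x∷ : _ ∉ x ∷ xs ++ ys
  y∉x∷ (here y≡x)  = x≢y (sym y≡x)
  y∉x∷ (there y∈) = y∉ y∈

∑-∈-unique : ∀ {N} (L : List (Fin N)) (p : Fin N → Bool) → Unique L →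
             ∑[ z < N ] 𝟙 (does (z ∈? L) ∧ p z) ≡ ∑[ z ∈ L ] 𝟙 (p z)
∑-∈-unique {N} []      p u = trans (∑-const N 0) (*-zeroʳ N)
∑-∈-unique {N} (a ∷ L) p (a∉L ∷ u) = begin
  ∑[ z < N ] 𝟙 ((does (z ≟ a) ∨ does (z ∈? L)) ∧ p z)
    ≡⟨ ∑-cong N split ⟩
  ∑[ z < N ] (𝟙 (does (z ≟ a)) * 𝟙 (p z) + 𝟙 (does (z ∈? L) ∧ p z))
    ≡⟨ ∑-distrib-+ N _ _ ⟩
  ∑[ z < N ] (𝟙 (does (z ≟ a)) * 𝟙 (p z)) + ∑[ z < N ] 𝟙 (does (z ∈? L) ∧ p z)
    ≡⟨ cong₂ _+_ (∑-pick N a (𝟙 ∘ p)) (∑-∈-unique L p u) ⟩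
  𝟙 (p a) + ∑[ z ∈ L ] 𝟙 (p z) ∎
  where
  open ≡-Reasoning
  split : ∀ z → 𝟙 ((does (z ≟ a) ∨ does (z ∈? L)) ∧ p z)
                ≡ 𝟙 (does (z ≟ a)) * 𝟙 (p z) + 𝟙 (does (z ∈? L) ∧ p z)
  split z with z ≟ a
  ... | no _ = refl
  ... | yes refl rewrite dec-false (z ∈? L) (All¬⇒¬Any a∉L) =
    sym (trans (+-identityʳ _) (*-identityˡ _))

∑-unique-cover : ∀ {N} (L : List (Fin N)) (p : Fin N → Bool) → Unique L → (∀ z → p z ≡ true → z ∈ L) →
                 ∑[ z < N ] 𝟙 (p z) ≡ ∑[ z ∈ L ] 𝟙 (p z)
∑-unique-cover {N} L p u cover = trans (∑-cong N restrict) (∑-∈-unique L p u)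
  where
  restrict : ∀ z → 𝟙 (p z) ≡ 𝟙 (does (z ∈? L) ∧ p z)
  restrict z with p z in pz
  ... | true  rewrite dec-true (z ∈? L) (cover z pz) = refl
  ... | false rewrite ∧-zeroʳ (does (z ∈? L)) = refl

∑-∈-length : ∀ {N} (L : List (Fin N)) → Unique L → ∑[ z < N ] 𝟙 (does (z ∈? L)) ≡ length L
∑-∈-length {N} L u = begin
  ∑[ z < N ] 𝟙 (does (z ∈? L))           ≡⟨ ∑-cong N (λ z → cong 𝟙 (∧-identityʳ _)) ⟨
  ∑[ z < N ] 𝟙 (does (z ∈? L) ∧ true)    ≡⟨ ∑-∈-unique L (λ _ → true) u ⟩
  ∑[ z ∈ L ] 1                           ≡⟨ ∑ˡ-const L 1 ⟩
  length L * 1                           ≡⟨ *-identityʳ _ ⟩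
  length L                               ∎
  where open ≡-Reasoning

∈-middle⁻ : ∀ {A : Set} (xs : List A) {y z} ys → z ∈ xs ++ y ∷ ys → z ≡ y ⊎ z ∈ xs ++ ys
∈-middle⁻ xs ys z∈ with ∈-++⁻ xs z∈
... | inj₁ z∈xs         = inj₂ (∈-++⁺ˡ z∈xs)
... | inj₂ (here z≡y)   = inj₁ z≡y
... | inj₂ (there z∈ys) = inj₂ (∈-++⁺ʳ xs z∈ys)

∈-middle⁺ : ∀ {A : Set} (xs : List A) {y z} ys → z ∈ xs ++ ys → z ∈ xs ++ y ∷ ys
∈-middle⁺ xs ys z∈ with ∈-++⁻ xs z∈
... | inj₁ z∈xs = ∈-++⁺ˡ z∈xs
... | inj₂ z∈ys = ∈-++⁺ʳ xs (there z∈ys)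

-- The signature of an arrangement

module Inversions {N : ℕ} (key : Fin N → ℕ) (key-injective : ∀ {a b} → key a ≡ key b → a ≡ b) where

  open ≡-Reasoning

  _≺?_ : (a b : Fin N) → Dec (key a < key b)
  a ≺? b = key a <? key b

  Between : Fin N → Fin N → Fin N → Set
  Between p q z = key p < key z × key z < key q

  between? : ∀ p q z → Dec (Between p q z)
  between? p q z = (p ≺? z) ×-dec (z ≺? q)

  #between : Fin N → Fin N → List (Fin N) → ℕ
  #between p q L = ∑[ z ∈ L ] 𝟙 (does (between? p q z))

  below : Fin N → List (Fin N) → ℕ
  below c L = ∑[ b ∈ L ] 𝟙 (does (b ≺? c))

  inversions : List (Fin N) → ℕ
  inversions []      = 0
  inversions (a ∷ L) = below a L + inversions L

  rank : Fin N → ℕ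
  rank c = ∑[ z < N ] 𝟙 (does (z ≺? c))

  -- Putting q in place of p changes the inversions, mod 2, by the number of
  -- colours of the rest strictly between p and q, and the rank by one more than
  -- the number of all colours between them.  When the rest contains every colour
  -- between them, the weight therefore changes by an odd number.
  weight : List (Fin N) → ℕ
  weight L = inversions L + ∑[ c ∈ L ] rank c

  signature : List (Fin N) → Parity
  signature L = parity (weight L)

  ≢⇒key≢ : ∀ {a b} → a ≢ b → key a ≢ key b
  ≢⇒key≢ a≢b = a≢b ∘ key-injective

  Between⇒≢ : ∀ {p q z} → Between p q z → z ≢ p × z ≢ q
  Between⇒≢ (p≺z , z≺q) = (λ { refl → <-irrefl refl p≺z }) , (λ { refl → <-irrefl refl z≺q })

  module _ {p q : Fin N} (p≺q : key p < key q) where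

    𝟙-≺-split : ∀ z → 𝟙 (does (z ≺? q))
                      ≡ 𝟙 (does (z ≟ p)) + 𝟙 (does (z ≺? p)) + 𝟙 (does (between? p q z))
    𝟙-≺-split z with <-cmp (key z) (key p)
    ... | tri< z≺p z≉p _
      rewrite dec-true (z ≺? q) (<-trans z≺p p≺q) | dec-false (z ≟ p) (z≉p ∘ cong key)
            | dec-true (z ≺? p) z≺p | dec-false (p ≺? z) (<-asym z≺p) = refl
    ... | tri≈ _ z≈p _ with refl ← key-injective z≈p
      rewrite dec-true (z ≺? q) p≺q | dec-true (z ≟ z) refl
            | dec-false (z ≺? z) (<-irrefl refl) = refl
    ... | tri> _ z≉p p≺z
      rewrite dec-false (z ≟ p) (z≉p ∘ cong key) | dec-false (z ≺? p) (<-asym p≺z)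
            | dec-true (p ≺? z) p≺z = refl

    𝟙-≻-split : ∀ {a} → a ≢ p → a ≢ q →
                𝟙 (does (p ≺? a)) ≡ 𝟙 (does (q ≺? a)) + 𝟙 (does (between? p q a))
    𝟙-≻-split {a} a≢p a≢q with <-cmp (key a) (key p)
    ... | tri< a≺p _ _
      rewrite dec-false (p ≺? a) (<-asym a≺p) | dec-false (q ≺? a) (<-asym (<-trans a≺p p≺q)) = refl
    ... | tri≈ _ a≈p _ = contradiction a≈p (≢⇒key≢ a≢p)
    ... | tri> _ _ p≺a rewrite dec-true (p ≺? a) p≺a with <-cmp (key a) (key q)
    ...   | tri< a≺q _ _ rewrite dec-false (q ≺? a) (<-asym a≺q) | dec-true (a ≺? q) a≺q = refl
    ...   | tri≈ _ a≈q _ = contradiction a≈q (≢⇒key≢ a≢q)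
    ...   | tri> _ _ q≺a rewrite dec-true (q ≺? a) q≺a | dec-false (a ≺? q) (<-asym q≺a) = refl

    below-replace : ∀ B → p ∉ B → below q B ≡ below p B + #between p q B
    below-replace []      _   = refl
    below-replace (b ∷ B) p∉ = begin
      𝟙 (does (b ≺? q)) + below q B
        ≡⟨ cong₂ _+_ (𝟙-≺-split b) (below-replace B (p∉ ∘ there)) ⟩
      𝟙 (does (b ≟ p)) + 𝟙 (does (b ≺? p)) + 𝟙 (does (between? p q b)) + (below p B + #between p q B)
        ≡⟨ cong (λ x → 𝟙 x + 𝟙 (does (b ≺? p)) + 𝟙 (does (between? p q b)) + (below p B + #between p q B))
                (dec-false (b ≟ p) (λ b≡p → p∉ (here (sym b≡p)))) ⟩
      𝟙 (does (b ≺? p)) + 𝟙 (does (between? p q b)) + (below p B + #between p q B)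
        ≡⟨ +-interchange (𝟙 (does (b ≺? p))) _ _ _ ⟩
      𝟙 (does (b ≺? p)) + below p B + (𝟙 (does (between? p q b)) + #between p q B) ∎

    inversions-replace : ∀ A B → p ∉ A ++ B → q ∉ A ++ B →
      inversions (A ++ q ∷ B) + #between p q A ≡ inversions (A ++ p ∷ B) + #between p q B
    inversions-replace [] B p∉ q∉ = begin
      below q B + inversions B + 0                  ≡⟨ +-identityʳ _ ⟩
      below q B + inversions B                      ≡⟨ cong (_+ inversions B) (below-replace B p∉) ⟩
      below p B + #between p q B + inversions B     ≡⟨ +-assoc (below p B) _ _ ⟩
      below p B + (#between p q B + inversions B)   ≡⟨ cong (below p B +_) (+-comm (#between p q B) _) ⟩
      below p B + (inversions B + #between p q B)   ≡⟨ +-assoc (below p B) _ _ ⟨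
      below p B + inversions B + #between p q B     ∎
    inversions-replace (a ∷ A) B p∉ q∉ = begin
      below a (A ++ q ∷ B) + inversions (A ++ q ∷ B) + (t + #between p q A)
        ≡⟨ cong (λ x → x + inversions (A ++ q ∷ B) + (t + #between p q A)) (∑ˡ-++ A (q ∷ B) _) ⟩
      x + (u + y) + I + (t + α)
        ≡⟨ solve 6 (λ x u y I t α → x :+ (u :+ y) :+ I :+ (t :+ α) := x :+ ((u :+ t) :+ y) :+ (I :+ α))
                   refl x u y I t α ⟩
      x + (u + t + y) + (I + α)
        ≡⟨ cong₂ (λ s r → x + (s + y) + r) (sym (𝟙-≻-split a≢p a≢q))
                                            (inversions-replace A B (p∉ ∘ there) (q∉ ∘ there)) ⟩
      x + (𝟙 (does (p ≺? a)) + y) + (inversions (A ++ p ∷ B) + #between p q B)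
        ≡⟨ +-assoc (x + (𝟙 (does (p ≺? a)) + y)) _ _ ⟨
      x + (𝟙 (does (p ≺? a)) + y) + inversions (A ++ p ∷ B) + #between p q B
        ≡⟨ cong (λ s → s + inversions (A ++ p ∷ B) + #between p q B) (∑ˡ-++ A (p ∷ B) _) ⟨
      below a (A ++ p ∷ B) + inversions (A ++ p ∷ B) + #between p q B ∎
      where
      x y u t I α : ℕ
      x = below a A
      y = below a B
      u = 𝟙 (does (q ≺? a))
      t = 𝟙 (does (between? p q a))
      I = inversions (A ++ q ∷ B)
      α = #between p q A
      a≢p : a ≢ p
      a≢p a≡p = p∉ (here (sym a≡p))
      a≢q : a ≢ q
      a≢q a≡q = q∉ (here (sym a≡q))

    rank-step : rank q ≡ suc (rank p + ∑[ z < N ] 𝟙 (does (between? p q z)))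
    rank-step = begin
      ∑[ z < N ] 𝟙 (does (z ≺? q))
        ≡⟨ ∑-cong N 𝟙-≺-split ⟩
      ∑[ z < N ] (𝟙 (does (z ≟ p)) + 𝟙 (does (z ≺? p)) + 𝟙 (does (between? p q z)))
        ≡⟨ ∑-distrib-+ N _ _ ⟩
      ∑[ z < N ] (𝟙 (does (z ≟ p)) + 𝟙 (does (z ≺? p))) + ∑[ z < N ] 𝟙 (does (between? p q z))
        ≡⟨ cong (_+ ∑[ z < N ] 𝟙 (does (between? p q z))) (∑-distrib-+ N _ _) ⟩
      ∑[ z < N ] 𝟙 (does (z ≟ p)) + rank p + ∑[ z < N ] 𝟙 (does (between? p q z))
        ≡⟨ cong (λ s → s + rank p + ∑[ z < N ] 𝟙 (does (between? p q z))) one ⟩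
      suc (rank p) + ∑[ z < N ] 𝟙 (does (between? p q z)) ∎
      where
      one : ∑[ z < N ] 𝟙 (does (z ≟ p)) ≡ 1
      one = trans (∑-cong N λ z → sym (*-identityʳ _)) (∑-pick N p (λ _ → 1))

    module _ (A B : List (Fin N)) (p∉ : p ∉ A ++ B) (q∉ : q ∉ A ++ B) (u : Unique (A ++ B))
             (covered : ∀ {z} → Between p q z → z ∈ A ++ B) where

      #between-all : ∑[ z < N ] 𝟙 (does (between? p q z)) ≡ #between p q A + #between p q B
      #between-all = trans (∑-unique-cover (A ++ B) _ u cover) (∑ˡ-++ A B _)
        where
        cover : ∀ z → does (between? p q z) ≡ true → z ∈ A ++ B
        cover z e = covered (from-does (between? p q z) e)

      weight-replace : weight (A ++ q ∷ B) ≡ suc (weight (A ++ p ∷ B) + 2 * #between p q B)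
      weight-replace = +-cancelʳ-≡ α _ _ (begin
        Iq + ∑ˡ (A ++ q ∷ B) rank + α
          ≡⟨ cong (λ s → Iq + s + α) (∑ˡ-++ A (q ∷ B) rank) ⟩
        Iq + (R + (rank q + S)) + α
          ≡⟨ solve 5 (λ Iq R r S α → Iq :+ (R :+ (r :+ S)) :+ α := (Iq :+ α) :+ (R :+ r :+ S))
                     refl Iq R (rank q) S α ⟩
        (Iq + α) + (R + rank q + S)
          ≡⟨ cong₂ (λ i r → i + (R + r + S)) (inversions-replace A B p∉ q∉)
                   (trans rank-step (cong (λ s → suc (rank p + s)) #between-all)) ⟩
        (Ip + β) + (R + suc (rank p + (α + β)) + S)
          ≡⟨ solve 6 (λ Ip β R r α S → (Ip :+ β) :+ (R :+ (con 1 :+ (r :+ (α :+ β))) :+ S)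
                                       := con 1 :+ (Ip :+ (R :+ (r :+ S)) :+ con 2 :* β) :+ α)
                     refl Ip β R (rank p) α S ⟩
        suc (Ip + (R + (rank p + S)) + 2 * β) + α
          ≡⟨ cong (λ s → suc (Ip + s + 2 * β) + α) (∑ˡ-++ A (p ∷ B) rank) ⟨
        suc (weight (A ++ p ∷ B) + 2 * β) + α ∎)
        where
        Iq Ip R S α β : ℕ
        Iq = inversions (A ++ q ∷ B)
        Ip = inversions (A ++ p ∷ B)
        R = ∑ˡ A rank
        S = ∑ˡ B rank
        α = #between p q A
        β = #between p q B

      signature-replace : signature (A ++ q ∷ B) ≡ signature (A ++ p ∷ B) ⁻¹
      signature-replace =
        trans (cong parity weight-replace) (parity-flip (weight (A ++ p ∷ B)) (#between p q B))
        where
        parity-flip : ∀ n m → parity (suc (n + 2 * m)) ≡ parity n ⁻¹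
        parity-flip n m = begin
          parity (suc (n + 2 * m))       ≡⟨ ℙ.⁻¹-selfInverse (ℙ.suc-homo-⁻¹ (n + 2 * m)) ⟨
          parity (n + 2 * m) ⁻¹          ≡⟨ cong _⁻¹ (ℙ.+-homo-+ n (2 * m)) ⟩
          (parity n +ℙ parity (2 * m)) ⁻¹ ≡⟨ cong (λ x → (parity n +ℙ x) ⁻¹) (ℙ.*-homo-* 2 m) ⟩
          (parity n +ℙ 0ℙ) ⁻¹            ≡⟨ cong _⁻¹ (ℙ.+-identityʳ (parity n)) ⟩
          parity n ⁻¹                    ∎

  signature-swap : ∀ {p q} A B → p ≢ q → p ∉ A ++ B → q ∉ A ++ B → Unique (A ++ B) →
                   (∀ {z} → Between p q z ⊎ Between q p z → z ∈ A ++ B) →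
                   signature (A ++ q ∷ B) ≡ signature (A ++ p ∷ B) ⁻¹
  signature-swap {p} {q} A B p≢q p∉ q∉ u covered with <-cmp (key p) (key q)
  ... | tri< p≺q _ _ = signature-replace p≺q A B p∉ q∉ u (covered ∘ inj₁)
  ... | tri≈ _ p≈q _ = contradiction p≈q (≢⇒key≢ p≢q)
  ... | tri> _ _ q≺p = sym (ℙ.⁻¹-selfInverse (sym (signature-replace q≺p A B q∉ p∉ u (covered ∘ inj₂))))

-- The strategy

[m%d+n]%d≡[m+n]%d : ∀ a b m .{{_ : NonZero m}} → (a % m + b) % m ≡ (a + b) % m
[m%d+n]%d≡[m+n]%d a b m = begin
  (a % m + b) % m
    ≡⟨ [m+kn]%n≡m%n (a % m + b) (a / m) m ⟨
  (a % m + b + a / m * m) % m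
    ≡⟨ cong (_% m) (solve 3 (λ r b q → r :+ b :+ q := r :+ q :+ b) refl (a % m) b (a / m * m)) ⟩
  (a % m + a / m * m + b) % m
    ≡⟨ cong (λ x → (x + b) % m) (m≡m%n+[m/n]*n a m) ⟨
  (a + b) % m                    ∎
  where open ≡-Reasoning

+-cancelˡ-% : ∀ v {a b} m .{{_ : NonZero m}} → a < m → b < m → (v + a) % m ≡ (v + b) % m → a ≡ b
+-cancelˡ-% v {a} {b} m a<m b<m e =
  trans (sym (recover a<m)) (trans (cong (λ x → (x + w) % m) e) (recover b<m))
  where
  open ≡-Reasoning
  -- v + w is a multiple of m, so adding w to (v + x) % m recovers x < m.
  w : ℕ
  w = m ∸ v % m
  v+w≡ : v + w ≡ suc (v / m) * m
  v+w≡ = begin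
    v + w                         ≡⟨ cong (_+ w) (m≡m%n+[m/n]*n v m) ⟩
    v % m + v / m * m + w         ≡⟨ solve 3 (λ r q w → r :+ q :+ w := r :+ w :+ q) refl (v % m) (v / m * m) w ⟩
    v % m + w + v / m * m         ≡⟨ cong (_+ v / m * m) (m+[n∸m]≡n (<⇒≤ (m%n<n v m))) ⟩
    m + v / m * m                 ∎
  recover : ∀ {x} → x < m → ((v + x) % m + w) % m ≡ x
  recover {x} x<m = begin
    ((v + x) % m + w) % m         ≡⟨ [m%d+n]%d≡[m+n]%d (v + x) w m ⟩
    (v + x + w) % m               ≡⟨ cong (_% m) (solve 3 (λ v x w → v :+ x :+ w := x :+ (v :+ w)) refl v x w) ⟩
    (x + (v + w)) % m             ≡⟨ cong (λ y → (x + y) % m) v+w≡ ⟩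
    (x + suc (v / m) * m) % m     ≡⟨ [m+kn]%n≡m%n x (suc (v / m)) m ⟩
    x % m                         ≡⟨ m<n⇒m%n≡m x<m ⟩
    x                             ∎

module ColourOrder {N m : ℕ} (f : Vec (Fin m) N) where

  -- Orders the colours lexicographically by (label, colour).
  key : Fin N → ℕ
  key c = toℕ (Fin.combine (lookup f c) c)

  key-injective : ∀ {a b} → key a ≡ key b → a ≡ b
  key-injective {a} {b} e =
    cong proj₂ (trans (sym (remQuot-combine (lookup f a) a))
               (trans (cong (Fin.remQuot N) (toℕ-injective e)) (remQuot-combine (lookup f b) b)))

  open Inversions key key-injective public

  Between⇒same-label : ∀ {p q z} → Between p q z → lookup f p ≡ lookup f q → lookup f z ≡ lookup f p
  Between⇒same-label {p} {q} {z} (p≺z , z≺q) fp≡fq with Fin.<-cmp (lookup f z) (lookup f p)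
  ... | tri< fz<fp _ _ = contradiction (combine-monoˡ-< z p fz<fp) (<-asym p≺z)
  ... | tri≈ _ fz≡fp _ = fz≡fp
  ... | tri> _ _ fp<fz =
    contradiction (combine-monoˡ-< q z (subst (Fin._< lookup f z) fp≡fq fp<fz)) (<-asym z≺q)

firstOr : ∀ {A : Set} → A → List A → A
firstOr d []      = d
firstOr d (x ∷ _) = x

firstOr-boolFilter : ∀ {A : Set} d (p : A → Bool) {c} xs → c ∈ xs → p c ≡ true → (∀ x → p x ≡ true → x ≡ c) →
                     firstOr d (boolFilter p xs) ≡ c
firstOr-boolFilter d p (x ∷ xs) c∈ pc unique with p x in px
... | true = unique x px
firstOr-boolFilter d p (x ∷ xs) (here refl) pc unique | false = contradiction (trans (sym px) pc) λ ()
firstOr-boolFilter d p (x ∷ xs) (there c∈) pc unique | false = firstOr-boolFilter d p xs c∈ pc unique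

module Labelling {N m : ℕ} .{{_ : NonZero m}} (f : Vec (Fin m) N) (d : Fin N) where

  open ColourOrder f
  open ≡-Reasoning

  label : Fin N → ℕ
  label c = toℕ (lookup f c)

  unseenLabelSum : List (Fin N) → ℕ
  unseenLabelSum L = ∑[ z < N ] (𝟙 (does (z ∉? L)) * label z)

  -- The colours outside A ++ B are the unused ones and the true colour, so when r
  -- is the label sum of the unused colours the true colour passes the test.
  Candidate : ℕ → Parity → List (Fin N) → List (Fin N) → Fin N → Set
  Candidate r ε A B c =
    c ∉ A ++ B × unseenLabelSum (A ++ B) % m ≡ (r + label c) % m × signature (A ++ c ∷ B) ≡ ε

  candidate? : ∀ r ε A B c → Dec (Candidate r ε A B c)
  candidate? r ε A B c = (c ∉? A ++ B) ×-dec (_ ℕ.≟ _) ×-dec (_ ℙ.≟ ε)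

  guess : ℕ → Parity → List (Fin N) → List (Fin N) → Fin N
  guess r ε A B = firstOr d (boolFilter (does ∘ candidate? r ε A B) (allFin N))

  unseenLabelSum-middle : ∀ A c B → c ∉ A ++ B →
                          unseenLabelSum (A ++ B) ≡ unseenLabelSum (A ++ c ∷ B) + label c
  unseenLabelSum-middle A c B c∉ = begin
    ∑[ z < N ] (𝟙 (does (z ∉? A ++ B)) * label z)
      ≡⟨ ∑-cong N split ⟩
    ∑[ z < N ] (𝟙 (does (z ∉? A ++ c ∷ B)) * label z + 𝟙 (does (z ≟ c)) * label z)
      ≡⟨ ∑-distrib-+ N _ _ ⟩
    unseenLabelSum (A ++ c ∷ B) + ∑[ z < N ] (𝟙 (does (z ≟ c)) * label z)
      ≡⟨ cong (unseenLabelSum (A ++ c ∷ B) +_) (∑-pick N c label) ⟩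
    unseenLabelSum (A ++ c ∷ B) + label c ∎
    where
    split : ∀ z → 𝟙 (does (z ∉? A ++ B)) * label z
                ≡ 𝟙 (does (z ∉? A ++ c ∷ B)) * label z + 𝟙 (does (z ≟ c)) * label z
    split z with z ≟ c
    ... | yes refl
      rewrite dec-true (z ∉? A ++ B) c∉ | dec-false (z ∉? A ++ c ∷ B) (λ z∉ → z∉ (∈-insert A)) = refl
    ... | no z≢c with z ∈? A ++ B
    ...   | yes z∈ rewrite dec-false (z ∉? A ++ c ∷ B) (λ z∉ → z∉ (∈-middle⁺ A B z∈)) = refl
    ...   | no z∉
      rewrite dec-true (z ∉? A ++ c ∷ B) ([ z≢c , z∉ ]′ ∘ ∈-middle⁻ A B) = sym (+-identityʳ _)

  module _ (A : List (Fin N)) (c : Fin N) (B : List (Fin N)) (u : Unique (A ++ c ∷ B))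
           (inj : ∀ {z w} → z ∉ A ++ c ∷ B → w ∉ A ++ c ∷ B → lookup f z ≡ lookup f w → z ≡ w) where

    private
      X : List (Fin N)
      X = A ++ c ∷ B
      r : ℕ
      r = unseenLabelSum X % m
      ε : Parity
      ε = signature X
      c∉ : c ∉ A ++ B
      c∉ = proj₁ (Unique-middle A B u)

    true-colour-candidate : Candidate r ε A B c
    true-colour-candidate =
      c∉ , trans (cong (_% m) (unseenLabelSum-middle A c B c∉))
                 (sym ([m%d+n]%d≡[m+n]%d (unseenLabelSum X) (label c) m)) , refl

    same-label : ∀ {c′} → unseenLabelSum (A ++ B) % m ≡ (r + label c′) % m → lookup f c ≡ lookup f c′
    same-label {c′} sums = toℕ-injective (+-cancelˡ-% (unseenLabelSum X) m (toℕ<n _) (toℕ<n _) (begin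
      (unseenLabelSum X + label c) % m    ≡⟨ cong (_% m) (unseenLabelSum-middle A c B c∉) ⟨
      unseenLabelSum (A ++ B) % m         ≡⟨ sums ⟩
      (r + label c′) % m                  ≡⟨ [m%d+n]%d≡[m+n]%d (unseenLabelSum X) (label c′) m ⟩
      (unseenLabelSum X + label c′) % m   ∎))

    between-seen : ∀ {c′} → c′ ∉ X → lookup f c ≡ lookup f c′ →
                   ∀ {z} → Between c c′ z ⊎ Between c′ c z → z ∈ A ++ B
    between-seen {c′} c′∉X fc≡fc′ {z} between with z ∈? A ++ B
    ... | yes z∈ = z∈
    ... | no z∉ = contradiction (inj z∉X c′∉X fz≡fc′) z≢c′
      where
      z≢c : z ≢ c
      z≢c = [ proj₁ ∘ Between⇒≢ , proj₂ ∘ Between⇒≢ ]′ between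
      z≢c′ : z ≢ c′
      z≢c′ = [ proj₂ ∘ Between⇒≢ , proj₁ ∘ Between⇒≢ ]′ between
      z∉X : z ∉ X
      z∉X = [ z≢c , z∉ ]′ ∘ ∈-middle⁻ A B
      fz≡fc′ : lookup f z ≡ lookup f c′
      fz≡fc′ = [ (λ b → trans (Between⇒same-label b fc≡fc′) fc≡fc′)
               , (λ b → Between⇒same-label b (sym fc≡fc′)) ]′ between

    candidate-unique : ∀ {c′} → Candidate r ε A B c′ → c′ ≡ c
    candidate-unique {c′} (c′∉ , sums , sig) with c′ ≟ c
    ... | yes c′≡c = c′≡c
    ... | no c′≢c = contradiction (trans (sym sig) flipped) (ℙ.p≢p⁻¹ ε)
      where
      c′∉X : c′ ∉ X
      c′∉X = [ c′≢c , c′∉ ]′ ∘ ∈-middle⁻ A B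
      flipped : signature (A ++ c′ ∷ B) ≡ ε ⁻¹
      flipped = signature-swap A B (c′≢c ∘ sym) c∉ c′∉ (proj₂ (Unique-middle A B u))
                               (between-seen c′∉X (same-label sums))

  guess-correct : ∀ X → Unique X → (∀ {z w} → z ∉ X → w ∉ X → lookup f z ≡ lookup f w → z ≡ w) →
                  ∀ A c B → A ++ c ∷ B ≡ X → guess (unseenLabelSum X % m) (signature X) A B ≡ c
  guess-correct X u inj A c B refl =
    firstOr-boolFilter d _ (allFin N) (∈-allFin c)
      (dec-true (candidate? _ _ A B c) (true-colour-candidate A c B u inj))
      (λ c′ e → candidate-unique A c B u inj (from-does (candidate? _ _ A B c′) e))

map-proj₂-zip : ∀ {A B : Set} (as : List A) (bs : List B) →
                length bs ≤ length as → map proj₂ (zip as bs) ≡ bs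
map-proj₂-zip []       []       _         = refl
map-proj₂-zip (a ∷ as) []       _         = refl
map-proj₂-zip (a ∷ as) (b ∷ bs) (s≤s len) = cong (b ∷_) (map-proj₂-zip as bs len)

module _ {n N : ℕ} (G : List (Fin N) → List (Fin N) → Fin N) where

  run-correct : ∀ X → (∀ A c B → A ++ c ∷ B ≡ X → G A B ≡ c) →
                ∀ (line : List (Fin n × Fin N)) A → A ++ map proj₂ line ≡ X → run (λ _ → G) line A ≡ true
  run-correct X correct []             A e = refl
  run-correct X correct ((i , c) ∷ line) A e
    rewrite correct A c (map proj₂ line) e | trans (isYes≗does (c ≟ c)) (dec-true (c ≟ c) refl) =
    run-correct X correct line (A ++ [ c ]) (trans (++-assoc A [ c ] _) e)

  wins-correct : ∀ (x : Vec (Fin N) n) → (∀ A c B → A ++ c ∷ B ≡ toList x → G A B ≡ c) →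
                 wins? (λ _ → G) x ≡ true
  wins-correct x correct = run-correct (toList x) correct (zip (allFin n) (toList x)) []
    (map-proj₂-zip (allFin n) (toList x)
      (≤-reflexive (trans (length-toList x) (sym (length-tabulate (λ i → i))))))

-- Labellings injective on a set of colours

∑ˡ-allVecs : ∀ m N (g : Vec (Fin m) (suc N) → ℕ) →
             ∑ˡ (allVecs m (suc N)) g ≡ ∑[ c < m ] ∑[ f ∈ allVecs m N ] g (c ∷ᵛ f)
∑ˡ-allVecs m N g = begin
  ∑ˡ (allVecs m (suc N)) g                          ≡⟨ ∑ˡ-concatMap _ (allFin m) g ⟩
  ∑[ c ∈ allFin m ] ∑ˡ (map (c ∷ᵛ_) (allVecs m N)) g ≡⟨ ∑ˡ-cong (allFin m) (λ c → ∑ˡ-map (c ∷ᵛ_) (allVecs m N) g) ⟩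
  ∑[ c ∈ allFin m ] ∑[ f ∈ allVecs m N ] g (c ∷ᵛ f)  ≡⟨ ∑ˡ-allFin m _ ⟩
  ∑[ c < m ] ∑[ f ∈ allVecs m N ] g (c ∷ᵛ f)         ∎
  where open ≡-Reasoning

module _ {m : ℕ} where

  hits : ∀ {N} → Fin m → (Fin N → Bool) → Vec (Fin m) N → Bool
  hits c U []ᵛ      = false
  hits c U (a ∷ᵛ f) = (U zero ∧ does (c ≟ a)) ∨ hits c (U ∘ suc) f

  injectiveOn : ∀ {N} → (Fin N → Bool) → Vec (Fin m) N → Bool
  injectiveOn U []ᵛ      = true
  injectiveOn U (a ∷ᵛ f) = (not (U zero) ∨ not (hits a (U ∘ suc) f)) ∧ injectiveOn (U ∘ suc) f

  #_ : ∀ {N} → (Fin N → Bool) → ℕ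
  #_ {N} U = ∑[ z < N ] 𝟙 (U z)

  head-miss : ∀ {N} U a (f : Vec (Fin m) N) → injectiveOn U (a ∷ᵛ f) ≡ true → U zero ≡ true →
              hits a (U ∘ suc) f ≡ false
  head-miss U a f inj U0 with U zero | hits a (U ∘ suc) f | proj₁ (∧≡true⇒ {y = injectiveOn (U ∘ suc) f} inj)
  ... | true | false | _ = refl

  hits-sound : ∀ {N} c U (f : Vec (Fin m) N) → hits c U f ≡ false → ∀ z → U z ≡ true → lookup f z ≢ c
  hits-sound c U (a ∷ᵛ f) miss zero    Uz refl rewrite Uz | dec-true (a ≟ a) refl = case miss of λ ()
  hits-sound c U (a ∷ᵛ f) miss (suc z) Uz = hits-sound c (U ∘ suc) f (proj₂ (∨≡false⇒ miss)) z Uz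

  injectiveOn-sound : ∀ {N} U (f : Vec (Fin m) N) → injectiveOn U f ≡ true →
                      ∀ {z w} → U z ≡ true → U w ≡ true → lookup f z ≡ lookup f w → z ≡ w
  injectiveOn-sound U (a ∷ᵛ f) inj {zero}  {zero}  Uz Uw eq = refl
  injectiveOn-sound U (a ∷ᵛ f) inj {zero}  {suc w} Uz Uw eq =
    contradiction (sym eq) (hits-sound a (U ∘ suc) f (head-miss U a f inj Uz) w Uw)
  injectiveOn-sound U (a ∷ᵛ f) inj {suc z} {zero}  Uz Uw eq =
    contradiction eq (hits-sound a (U ∘ suc) f (head-miss U a f inj Uw) z Uz)
  injectiveOn-sound U (a ∷ᵛ f) inj {suc z} {suc w} Uz Uw eq =
    cong suc (injectiveOn-sound (U ∘ suc) f (proj₂ (∧≡true⇒ inj)) Uz Uw eq)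

  #hits≤# : ∀ {N} U (f : Vec (Fin m) N) → ∑[ c < m ] 𝟙 (hits c U f) ≤ # U
  #hits≤# U []ᵛ      = ≤-reflexive (trans (∑-const m 0) (*-zeroʳ m))
  #hits≤# U (a ∷ᵛ f) = begin
    ∑[ c < m ] 𝟙 ((U zero ∧ does (c ≟ a)) ∨ hits c (U ∘ suc) f)
      ≤⟨ ∑-mono-≤ m (λ c → 𝟙-∨ (U zero ∧ does (c ≟ a)) _) ⟩
    ∑[ c < m ] (𝟙 (U zero ∧ does (c ≟ a)) + 𝟙 (hits c (U ∘ suc) f))
      ≡⟨ ∑-distrib-+ m _ _ ⟩
    ∑[ c < m ] 𝟙 (U zero ∧ does (c ≟ a)) + ∑[ c < m ] 𝟙 (hits c (U ∘ suc) f)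
      ≤⟨ +-mono-≤ (≤-reflexive (head-hits (U zero))) (#hits≤# (U ∘ suc) f) ⟩
    𝟙 (U zero) + # (U ∘ suc) ∎
    where
    open ≤-Reasoning
    head-hits : ∀ u → ∑[ c < m ] 𝟙 (u ∧ does (c ≟ a)) ≡ 𝟙 u
    head-hits true  = trans (∑-cong m λ c → sym (*-identityʳ _)) (∑-pick m a (λ _ → 1))
    head-hits false = trans (∑-const m 0) (*-zeroʳ m)

  m∸#≤#misses : ∀ {N} U (f : Vec (Fin m) N) → m ∸ # U ≤ ∑[ c < m ] 𝟙 (not (hits c U f))
  m∸#≤#misses U f = m≤n+o⇒m∸n≤o m (# U) (begin
    m                                                                  ≡⟨ *-identityʳ m ⟨
    m * 1                                                              ≡⟨ ∑-const m 1 ⟨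
    ∑[ c < m ] 1                                                       ≡⟨ ∑-cong m (λ c → 𝟙-not (hits c U f)) ⟨
    ∑[ c < m ] (𝟙 (not (hits c U f)) + 𝟙 (hits c U f))                ≡⟨ ∑-distrib-+ m _ _ ⟩
    ∑[ c < m ] 𝟙 (not (hits c U f)) + ∑[ c < m ] 𝟙 (hits c U f)      ≤⟨ +-monoʳ-≤ _ (#hits≤# U f) ⟩
    ∑[ c < m ] 𝟙 (not (hits c U f)) + # U                            ≡⟨ +-comm _ (# U) ⟩
    # U + ∑[ c < m ] 𝟙 (not (hits c U f))                            ∎)
    where open ≤-Reasoning

  #injectiveOn : ∀ N → (Fin N → Bool) → ℕ
  #injectiveOn N U = ∑[ f ∈ allVecs m N ] 𝟙 (injectiveOn U f)

  #injectiveOn-unconstrained : ∀ N U → U zero ≡ false → #injectiveOn (suc N) U ≡ m * #injectiveOn N (U ∘ suc)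
  #injectiveOn-unconstrained N U U0 = begin
    #injectiveOn (suc N) U
      ≡⟨ ∑ˡ-allVecs m N _ ⟩
    ∑[ c < m ] ∑[ f ∈ allVecs m N ] 𝟙 ((not (U zero) ∨ not (hits c (U ∘ suc) f)) ∧ injectiveOn (U ∘ suc) f)
      ≡⟨ ∑-cong m (λ c → ∑ˡ-cong (allVecs m N) λ f →
           cong (λ u → 𝟙 ((not u ∨ not (hits c (U ∘ suc) f)) ∧ injectiveOn (U ∘ suc) f)) U0) ⟩
    ∑[ c < m ] #injectiveOn N (U ∘ suc)
      ≡⟨ ∑-const m _ ⟩
    m * #injectiveOn N (U ∘ suc) ∎
    where open ≡-Reasoning

  #injectiveOn-constrained : ∀ N U → U zero ≡ true →
                             (m ∸ # (U ∘ suc)) * #injectiveOn N (U ∘ suc) ≤ #injectiveOn (suc N) U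
  #injectiveOn-constrained N U U0 = begin
    (m ∸ # U′) * #injectiveOn N U′
      ≡⟨ *-distribˡ-∑ˡ (allVecs m N) (m ∸ # U′) (𝟙 ∘ injectiveOn U′) ⟩
    ∑[ f ∈ allVecs m N ] ((m ∸ # U′) * 𝟙 (injectiveOn U′ f))
      ≤⟨ ∑ˡ-mono-≤ (allVecs m N) (λ f → *-monoˡ-≤ (𝟙 (injectiveOn U′ f)) (m∸#≤#misses U′ f)) ⟩
    ∑[ f ∈ allVecs m N ] (∑[ c < m ] 𝟙 (not (hits c U′ f)) * 𝟙 (injectiveOn U′ f))
      ≡⟨ ∑ˡ-cong (allVecs m N) (λ f → *-distribʳ-∑ m _ _) ⟩
    ∑[ f ∈ allVecs m N ] ∑[ c < m ] (𝟙 (not (hits c U′ f)) * 𝟙 (injectiveOn U′ f))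
      ≡⟨ ∑-∑ˡ-swap m (allVecs m N) _ ⟨
    ∑[ c < m ] ∑[ f ∈ allVecs m N ] (𝟙 (not (hits c U′ f)) * 𝟙 (injectiveOn U′ f))
      ≡⟨ ∑-cong m (λ c → ∑ˡ-cong (allVecs m N) λ f → sym (𝟙-∧ (not (hits c U′ f)) _)) ⟩
    ∑[ c < m ] ∑[ f ∈ allVecs m N ] 𝟙 (not (hits c U′ f) ∧ injectiveOn U′ f)
      ≡⟨ ∑-cong m (λ c → ∑ˡ-cong (allVecs m N) λ f →
           cong (λ u → 𝟙 ((not u ∨ not (hits c U′ f)) ∧ injectiveOn U′ f)) (sym U0)) ⟩
    ∑[ c < m ] ∑[ f ∈ allVecs m N ] 𝟙 ((not (U zero) ∨ not (hits c U′ f)) ∧ injectiveOn U′ f)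
      ≡⟨ ∑ˡ-allVecs m N _ ⟨
    #injectiveOn (suc N) U ∎
    where
    open ≤-Reasoning
    U′ : Fin N → Bool
    U′ = U ∘ suc

  -- m P′ u is the falling factorial m(m − 1)⋯(m − u + 1), also for u > m (then 0).
  #injectiveOn-bound : ∀ N U → (m P′ # U) * m ^ N ≤ #injectiveOn N U * m ^ (# U)
  #injectiveOn-bound zero    U = ≤-refl
  #injectiveOn-bound (suc N) U with U zero in U0
  ... | false = begin
    (m P′ u) * (m * m ^ N)           ≡⟨ x*[y*z]≡y*[x*z] (m P′ u) m (m ^ N) ⟩
    m * ((m P′ u) * m ^ N)           ≤⟨ *-monoʳ-≤ m (#injectiveOn-bound N U′) ⟩
    m * (I * m ^ u)                  ≡⟨ *-assoc m I _ ⟨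
    m * I * m ^ u                    ≡⟨ cong (_* m ^ u) (#injectiveOn-unconstrained N U U0) ⟨
    #injectiveOn (suc N) U * m ^ u   ∎
    where
    open ≤-Reasoning
    U′ : Fin N → Bool
    U′ = U ∘ suc
    u I : ℕ
    u = # U′
    I = #injectiveOn N U′
  ... | true = begin
    (m ∸ u) * (m P′ u) * (m * m ^ N)         ≡⟨ *-interchange (m ∸ u) (m P′ u) m (m ^ N) ⟩
    (m ∸ u) * m * ((m P′ u) * m ^ N)         ≤⟨ *-monoʳ-≤ ((m ∸ u) * m) (#injectiveOn-bound N U′) ⟩
    (m ∸ u) * m * (I * m ^ u)                ≡⟨ *-interchange (m ∸ u) m I (m ^ u) ⟩
    (m ∸ u) * I * (m * m ^ u)                ≤⟨ *-monoˡ-≤ (m * m ^ u) (#injectiveOn-constrained N U U0) ⟩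
    #injectiveOn (suc N) U * (m * m ^ u)     ∎
    where
    open ≤-Reasoning
    U′ : Fin N → Bool
    U′ = U ∘ suc
    u I : ℕ
    u = # U′
    I = #injectiveOn N U′

length-allVecs : ∀ m N → length (allVecs m N) ≡ m ^ N
length-allVecs m zero    = refl
length-allVecs m (suc N) = begin
  length (allVecs m (suc N))
    ≡⟨ length-concatMap _ (allFin m) ⟩
  ∑[ c ∈ allFin m ] length (map (c ∷ᵛ_) (allVecs m N))
    ≡⟨ ∑ˡ-cong (allFin m) (λ c → length-map (c ∷ᵛ_) (allVecs m N)) ⟩
  ∑[ c ∈ allFin m ] length (allVecs m N)
    ≡⟨ ∑ˡ-const (allFin m) _ ⟩
  length (allFin m) * length (allVecs m N)
    ≡⟨ cong₂ _*_ (length-tabulate {n = m} (λ c → c)) (length-allVecs m N) ⟩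
  m * m ^ N                                                 ∎
  where open ≡-Reasoning

∈-allVecs : ∀ m N (v : Vec (Fin m) N) → v ∈ allVecs m N
∈-allVecs m zero    []ᵛ      = here refl
∈-allVecs m (suc N) (c ∷ᵛ v) = ∈-concatMap⁺ _ (lose (∈-allFin c) (∈-map⁺ (c ∷ᵛ_) (∈-allVecs m N v)))

-- Averaging over strategies

injective?⇒Unique : ∀ {N n} (x : Vec (Fin N) n) → injective? x ≡ true → Unique (toList x)
injective?⇒Unique x e = from-does (UniqueDec.unique? _≟_ (toList x)) (trans (sym (isYes≗does _)) e)

#unused≡k : ∀ n k (x : Vec (Fin (n + k)) n) → Unique (toList x) → ∑[ z < n + k ] 𝟙 (does (z ∉? toList x)) ≡ k
#unused≡k n k x u = +-cancelʳ-≡ n _ k (begin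
  ∑[ z < n + k ] 𝟙 (not (does (z ∈? X))) + n
    ≡⟨ cong (∑[ z < n + k ] 𝟙 (not (does (z ∈? X))) +_) (trans (∑-∈-length X u) (length-toList x)) ⟨
  ∑[ z < n + k ] 𝟙 (not (does (z ∈? X))) + ∑[ z < n + k ] 𝟙 (does (z ∈? X))
    ≡⟨ ∑-distrib-+ (n + k) _ _ ⟨
  ∑[ z < n + k ] (𝟙 (not (does (z ∈? X))) + 𝟙 (does (z ∈? X)))
    ≡⟨ ∑-cong (n + k) (λ z → 𝟙-not (does (z ∈? X))) ⟩
  ∑[ z < n + k ] 1
    ≡⟨ trans (∑-const (n + k) 1) (*-identityʳ (n + k)) ⟩
  n + k
    ≡⟨ +-comm n k ⟩
  k + n ∎)
  where
  open ≡-Reasoning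
  X : List (Fin (n + k))
  X = toList x

toList-tabulate : ∀ {A : Set} n (h : Fin n → A) → toList (Vec.tabulate h) ≡ tabulate h
toList-tabulate zero    h = refl
toList-tabulate (suc n) h = cong (h zero ∷_) (toList-tabulate n (h ∘ suc))

1≤totalCount : ∀ n k → 1 ≤ totalCount n k
1≤totalCount n k = begin
  1
    ≡⟨ cong 𝟙 injective ⟨
  𝟙 (injective? x)
    ≤⟨ ∈⇒≤∑ˡ (allVecs (n + k) n) (𝟙 ∘ injective?) (∈-allVecs (n + k) n x) ⟩
  ∑[ y ∈ allVecs (n + k) n ] 𝟙 (injective? y)
    ≡⟨ length-boolFilter injective? (allVecs (n + k) n) ⟨
  totalCount n k                                        ∎
  where
  open ≤-Reasoning
  x : Vec (Fin (n + k)) n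
  x = Vec.tabulate (Fin._↑ˡ k)
  injective : injective? x ≡ true
  injective = trans (isYes≗does _) (dec-true (UniqueDec.unique? _≟_ (toList x))
    (subst Unique (sym (toList-tabulate n (Fin._↑ˡ k))) (Unique.tabulate⁺ (Fin.↑ˡ-injective k _ _))))

parities : List Parity
parities = 0ℙ ∷ 1ℙ ∷ []

∈-parities : ∀ ε → ε ∈ parities
∈-parities 0ℙ = here refl
∈-parities 1ℙ = there (here refl)

module Averaging (n k m : ℕ) .{{_ : NonZero m}} (d : Fin (n + k)) where

  Parameters : Set
  Parameters = Vec (Fin m) (n + k) × ℕ × Parity

  strategy : Parameters → Strategy n (n + k)
  strategy (f , r , ε) _ = Labelling.guess f d r ε

  parameters : List Parameters
  parameters = concatMap (λ f → concatMap (λ r → map (λ ε → f , r , ε) parities) (upTo m)) (allVecs m (n + k))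

  ∑ˡ-parameters : ∀ g →
    ∑ˡ parameters g ≡ ∑[ f ∈ allVecs m (n + k) ] ∑[ r ∈ upTo m ] ∑[ ε ∈ parities ] g (f , r , ε)
  ∑ˡ-parameters g =
    trans (∑ˡ-concatMap _ (allVecs m (n + k)) g) (∑ˡ-cong (allVecs m (n + k)) λ f →
    trans (∑ˡ-concatMap _ (upTo m) g) (∑ˡ-cong (upTo m) λ r → ∑ˡ-map (λ ε → f , r , ε) parities g))

  length-parameters : length parameters ≡ m ^ (n + k) * (m * 2)
  length-parameters = begin
    length parameters
      ≡⟨ *-identityʳ _ ⟨
    length parameters * 1
      ≡⟨ ∑ˡ-const parameters 1 ⟨
    ∑[ σ ∈ parameters ] 1
      ≡⟨ ∑ˡ-parameters (λ _ → 1) ⟩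
    ∑[ f ∈ allVecs m (n + k) ] ∑[ r ∈ upTo m ] 2
      ≡⟨ ∑ˡ-cong (allVecs m (n + k)) (λ f → ∑ˡ-const (upTo m) 2) ⟩
    ∑[ f ∈ allVecs m (n + k) ] (length (upTo m) * 2)
      ≡⟨ ∑ˡ-const (allVecs m (n + k)) _ ⟩
    length (allVecs m (n + k)) * (length (upTo m) * 2)
      ≡⟨ cong₂ (λ a b → a * (b * 2)) (length-allVecs m (n + k)) (length-upTo m) ⟩
    m ^ (n + k) * (m * 2)                                        ∎
    where open ≡-Reasoning

  unused : Vec (Fin (n + k)) n → Fin (n + k) → Bool
  unused x z = does (z ∉? toList x)

  #injectiveOn≤#winners : ∀ x → injective? x ≡ true →
                          #injectiveOn (n + k) (unused x) ≤ ∑[ σ ∈ parameters ] 𝟙 (wins? (strategy σ) x)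
  #injectiveOn≤#winners x inj? = begin
    ∑[ f ∈ allVecs m (n + k) ] 𝟙 (injectiveOn (unused x) f)
      ≤⟨ ∑ˡ-mono-≤ (allVecs m (n + k)) wins-for ⟩
    ∑[ f ∈ allVecs m (n + k) ] ∑[ r ∈ upTo m ] ∑[ ε ∈ parities ] 𝟙 (wins? (strategy (f , r , ε)) x)
      ≡⟨ ∑ˡ-parameters _ ⟨
    ∑[ σ ∈ parameters ] 𝟙 (wins? (strategy σ) x) ∎
    where
    open ≤-Reasoning
    X : List (Fin (n + k))
    X = toList x
    wins-for : ∀ f → 𝟙 (injectiveOn (unused x) f)
                     ≤ ∑[ r ∈ upTo m ] ∑[ ε ∈ parities ] 𝟙 (wins? (strategy (f , r , ε)) x)
    wins-for f with injectiveOn (unused x) f in inj-f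
    ... | false = z≤n
    ... | true = begin
      1
        ≡⟨ cong 𝟙 wins ⟨
      𝟙 (wins? (strategy (f , r₀ , ε₀)) x)
        ≤⟨ ∈⇒≤∑ˡ parities (λ ε → 𝟙 (wins? (strategy (f , r₀ , ε)) x)) (∈-parities ε₀) ⟩
      ∑[ ε ∈ parities ] 𝟙 (wins? (strategy (f , r₀ , ε)) x)
        ≤⟨ ∈⇒≤∑ˡ (upTo m) (λ r → ∑[ ε ∈ parities ] 𝟙 (wins? (strategy (f , r , ε)) x)) (∈-upTo⁺ (m%n<n _ m)) ⟩
      ∑[ r ∈ upTo m ] ∑[ ε ∈ parities ] 𝟙 (wins? (strategy (f , r , ε)) x) ∎
      where
      r₀ : ℕ
      r₀ = Labelling.unseenLabelSum f d X % m
      ε₀ : Parity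
      ε₀ = ColourOrder.signature f X
      injective : ∀ {z w} → z ∉ X → w ∉ X → lookup f z ≡ lookup f w → z ≡ w
      injective z∉ w∉ = injectiveOn-sound (unused x) f inj-f (dec-true (_ ∉? X) z∉) (dec-true (_ ∉? X) w∉)
      wins : wins? (strategy (f , r₀ , ε₀)) x ≡ true
      wins = wins-correct (Labelling.guess f d r₀ ε₀) x
                          (Labelling.guess-correct f d X (injective?⇒Unique x inj?) injective)

  wins : Parameters → ℕ
  wins σ = winCount n k (strategy σ)

  ∑-wins-bound : totalCount n k * ((m P′ k) * m ^ (n + k)) ≤ ∑ˡ parameters wins * m ^ k
  ∑-wins-bound = begin
    length A * ((m P′ k) * m ^ (n + k))
      ≡⟨ ∑ˡ-const A _ ⟨
    ∑[ x ∈ A ] ((m P′ k) * m ^ (n + k))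
      ≤⟨ ∑ˡ-boolFilter-mono-≤ injective? (allVecs (n + k) n) injectiveOn-bound ⟩
    ∑[ x ∈ A ] (#injectiveOn (n + k) (unused x) * m ^ k)
      ≤⟨ ∑ˡ-boolFilter-mono-≤ injective? (allVecs (n + k) n)
                              (λ x inj? → *-monoˡ-≤ (m ^ k) (#injectiveOn≤#winners x inj?)) ⟩
    ∑[ x ∈ A ] (∑[ σ ∈ parameters ] 𝟙 (wins? (strategy σ) x) * m ^ k)
      ≡⟨ *-distribʳ-∑ˡ A (m ^ k) _ ⟨
    ∑[ x ∈ A ] ∑[ σ ∈ parameters ] 𝟙 (wins? (strategy σ) x) * m ^ k
      ≡⟨ cong (_* m ^ k) (∑ˡ-swap A parameters _) ⟩
    ∑[ σ ∈ parameters ] ∑[ x ∈ A ] 𝟙 (wins? (strategy σ) x) * m ^ k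
      ≡⟨ cong (_* m ^ k) (∑ˡ-cong parameters λ σ → length-boolFilter (wins? (strategy σ)) A) ⟨
    ∑ˡ parameters wins * m ^ k ∎
    where
    open ≤-Reasoning
    A : List (Vec (Fin (n + k)) n)
    A = assignments n k
    injectiveOn-bound : ∀ x → injective? x ≡ true →
                        (m P′ k) * m ^ (n + k) ≤ #injectiveOn (n + k) (unused x) * m ^ k
    injectiveOn-bound x inj? =
      subst (λ u → (m P′ u) * m ^ (n + k) ≤ #injectiveOn (n + k) (unused x) * m ^ u)
            (#unused≡k n k x (injective?⇒Unique x inj?)) (#injectiveOn-bound (n + k) (unused x))

  good-parameters : Σ Parameters λ σ → totalCount n k * (m P′ k) ≤ wins σ * (2 * m * m ^ k)
  good-parameters
    with ∃-above-average parameters wins (Vec.replicate (n + k) (Fin.fromℕ< (>-nonZero⁻¹ m)) , 0 , 0ℙ)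
  ... | σ , average≤ = σ , *-cancelʳ-≤ _ _ (m ^ (n + k)) {{m^n≢0 m (n + k)}} (begin
    totalCount n k * (m P′ k) * m ^ (n + k)
      ≡⟨ *-assoc (totalCount n k) _ _ ⟩
    totalCount n k * ((m P′ k) * m ^ (n + k))
      ≤⟨ ∑-wins-bound ⟩
    ∑ˡ parameters wins * m ^ k
      ≤⟨ *-monoˡ-≤ (m ^ k) average≤ ⟩
    length parameters * wins σ * m ^ k
      ≡⟨ cong (λ l → l * wins σ * m ^ k) length-parameters ⟩
    m ^ (n + k) * (m * 2) * wins σ * m ^ k
      ≡⟨ solve 4 (λ M m w K → M :* (m :* con 2) :* w :* K := w :* (con 2 :* m :* K) :* M)
                 refl (m ^ (n + k)) m (wins σ) (m ^ k) ⟩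
    wins σ * (2 * m * m ^ k) * m ^ (n + k)         ∎)
    where open ≤-Reasoning

  success : ∀ T → 2 * m * m ^ k * T ! < k * k * (m P′ k) * eSumScaled T →
            Σ (Strategy n (n + k)) (SuccessAtLeastOneOverEK² n k)
  success T numeric = strategy σ , T , *-cancelʳ-< Q _ _ (begin-strict
      t * T ! * Q
        ≡⟨ solve 3 (λ t F Q → t :* F :* Q := t :* (Q :* F)) refl t (T !) Q ⟩
      t * (Q * T !)
        <⟨ *-monoʳ-< t numeric ⟩
      t * (k * k * P * E)
        ≡⟨ solve 4 (λ t K P E → t :* (K :* P :* E) := t :* P :* (K :* E)) refl t (k * k) P E ⟩
      t * P * (k * k * E)
        ≤⟨ *-monoˡ-≤ (k * k * E) σ-wins ⟩
      wins σ * Q * (k * k * E)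
        ≡⟨ solve 4 (λ w Q K E → w :* Q :* (K :* E) := K :* w :* E :* Q) refl (wins σ) Q (k * k) E ⟩
      k * k * wins σ * E * Q       ∎)
    where
    open ≤-Reasoning
    σ : Parameters
    σ = proj₁ good-parameters
    t Q P E : ℕ
    t = totalCount n k
    Q = 2 * m * m ^ k
    P = m P′ k
    E = eSumScaled T
    σ-wins : t * P ≤ wins σ * Q
    σ-wins = proj₂ good-parameters
    instance
      t≢0 : NonZero t
      t≢0 = >-nonZero (1≤totalCount n k)

-- (1 + 1/M)^M is at most the M-th partial sum of e

module _ where
  open import Algebra.Properties.CommutativeSemiring.Binomial +-*-commutativeSemiring as Binomial using ()
  open import Algebra.Properties.Semiring.Exp +-*-semiring as Exp using ()
  open import Algebra.Properties.Semiring.Mult +-*-semiring as Mult using ()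
  open import Algebra.Properties.Semiring.Sum +-*-semiring as Sum using ()

  binomial-theorem : ∀ M p → (1 + M) ^ p ≡ ∑[ j < suc p ] ((p C toℕ j) * M ^ (p ∸ toℕ j))
  binomial-theorem M p = begin
    (1 + M) ^ p                 ≡⟨ ^≡^ (1 + M) p ⟨
    (1 + M) Exp.^ p             ≡⟨ Binomial.theorem p 1 M ⟩
    Binomial.binomialExpansion 1 M p
                                ≡⟨ sum≡∑ (suc p) (Binomial.binomialTerm 1 M p) ⟩
    ∑[ j < suc p ] ((p C toℕ j) Mult.× (1 Exp.^ toℕ j * M Exp.^ (p ∸ toℕ j)))
                                ≡⟨ ∑-cong (suc p) term ⟩
    ∑[ j < suc p ] ((p C toℕ j) * M ^ (p ∸ toℕ j)) ∎
    where
    open ≡-Reasoning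
    ^≡^ : ∀ x n → x Exp.^ n ≡ x ^ n
    ^≡^ x zero    = refl
    ^≡^ x (suc n) = cong (x *_) (^≡^ x n)
    ×≡* : ∀ n x → n Mult.× x ≡ n * x
    ×≡* zero    x = refl
    ×≡* (suc n) x = cong (x +_) (×≡* n x)
    sum≡∑ : ∀ n (g : Fin n → ℕ) → Sum.sum g ≡ ∑ n g
    sum≡∑ zero    g = refl
    sum≡∑ (suc n) g = cong (g zero +_) (sum≡∑ n (g ∘ suc))
    term : ∀ j → (p C toℕ j) Mult.× (1 Exp.^ toℕ j * M Exp.^ (p ∸ toℕ j)) ≡ (p C toℕ j) * M ^ (p ∸ toℕ j)
    term j = begin
      (p C toℕ j) Mult.× (1 Exp.^ toℕ j * M Exp.^ (p ∸ toℕ j))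
        ≡⟨ ×≡* (p C toℕ j) _ ⟩
      (p C toℕ j) * (1 Exp.^ toℕ j * M Exp.^ (p ∸ toℕ j))
        ≡⟨ cong (λ x → (p C toℕ j) * (x * M Exp.^ (p ∸ toℕ j))) (trans (^≡^ 1 (toℕ j)) (^-zeroˡ (toℕ j))) ⟩
      (p C toℕ j) * (1 * M Exp.^ (p ∸ toℕ j))
        ≡⟨ cong ((p C toℕ j) *_) (trans (*-identityˡ _) (^≡^ M (p ∸ toℕ j))) ⟩
      (p C toℕ j) * M ^ (p ∸ toℕ j) ∎

n!/k!≡nCk*[n∸k]! : ∀ {n k} → k ≤ n → (n ! / k !) {{k !≢0}} ≡ (n C k) * (n ∸ k) !
n!/k!≡nCk*[n∸k]! {n} {k} k≤n = begin
  (n ! / k !) {{k !≢0}}                           ≡⟨ cong (λ x → (x / k !) {{k !≢0}}) factorisation ⟨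
  ((n C k) * (n ∸ k) ! * k ! / k !) {{k !≢0}}     ≡⟨ m*n/n≡m ((n C k) * (n ∸ k) !) (k !) {{k !≢0}} ⟩
  (n C k) * (n ∸ k) !                             ∎
  where
  open ≡-Reasoning
  factorisation : (n C k) * (n ∸ k) ! * k ! ≡ n !
  factorisation = begin
    (n C k) * (n ∸ k) ! * k !                     ≡⟨ x*[y*z]≡x*z*y (n C k) (k !) ((n ∸ k) !) ⟨
    (n C k) * (k ! * (n ∸ k) !)                   ≡⟨ cong (_* (k ! * (n ∸ k) !)) (nCk≡n!/k![n-k]! k≤n) ⟩
    (n ! / (k ! * (n ∸ k) !)) {{k !* (n ∸ k) !≢0}} * (k ! * (n ∸ k) !)
                                                  ≡⟨ m/n*n≡m {{k !* (n ∸ k) !≢0}} (k![n∸k]!∣n! k≤n) ⟩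
    n !                                           ∎

[k+r]!≤[k+r]^k*r! : ∀ k r → (k + r) ! ≤ (k + r) ^ k * r !
[k+r]!≤[k+r]^k*r! zero    r = ≤-reflexive (sym (+-identityʳ (r !)))
[k+r]!≤[k+r]^k*r! (suc k) r = begin
  suc (k + r) * (k + r) !
    ≤⟨ *-monoʳ-≤ (suc (k + r)) ([k+r]!≤[k+r]^k*r! k r) ⟩
  suc (k + r) * ((k + r) ^ k * r !)
    ≤⟨ *-monoʳ-≤ (suc (k + r)) (*-monoˡ-≤ (r !) (^-monoˡ-≤ k (n≤1+n (k + r)))) ⟩
  suc (k + r) * (suc (k + r) ^ k * r !)
    ≡⟨ *-assoc (suc (k + r)) (suc (k + r) ^ k) (r !) ⟨
  suc (k + r) ^ suc k * r !                ∎
  where open ≤-Reasoning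

binomial-term-bound : ∀ {j M} → j ≤ M → M ! * ((M C j) * M ^ (M ∸ j)) ≤ (M ! / j !) {{j !≢0}} * M ^ M
binomial-term-bound {j} {M} j≤M with r , refl ← m≤n⇒∃[o]m+o≡n j≤M = begin
  M ! * ((M C j) * M ^ (M ∸ j))
    ≡⟨ cong (λ e → M ! * ((M C j) * M ^ e)) (m+n∸m≡n j r) ⟩
  M ! * ((M C j) * M ^ r)
    ≤⟨ *-monoˡ-≤ ((M C j) * M ^ r) ([k+r]!≤[k+r]^k*r! j r) ⟩
  M ^ j * r ! * ((M C j) * M ^ r)
    ≡⟨ *-interchange (M ^ j) (r !) (M C j) (M ^ r) ⟩
  M ^ j * (M C j) * (r ! * M ^ r)
    ≡⟨ solve 4 (λ a c f b → a :* c :* (f :* b) := c :* f :* (a :* b)) refl (M ^ j) (M C j) (r !) (M ^ r) ⟩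
  (M C j) * r ! * (M ^ j * M ^ r)
    ≡⟨ cong₂ _*_ (sym (subst (λ x → (M ! / j !) {{j !≢0}} ≡ (M C j) * x !) (m+n∸m≡n j r)
                             (n!/k!≡nCk*[n∸k]! j≤M)))
        (sym (^-distribˡ-+-* M j r)) ⟩
  (M ! / j !) {{j !≢0}} * M ^ M            ∎
  where open ≤-Reasoning

eSumScaled≡∑ : ∀ M → eSumScaled M ≡ ∑[ j < suc M ] (M ! / toℕ j !) {{toℕ j !≢0}}
eSumScaled≡∑ M = go (suc M) (λ j → j)
  where
  go : ∀ n (f : ℕ → ℕ) → sum (map (λ j → (M ! / j !) {{j !≢0}}) (applyUpTo f n))
                       ≡ ∑[ j < n ] (M ! / f (toℕ j) !) {{f (toℕ j) !≢0}}
  go zero    f = refl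
  go (suc n) f = cong ((M ! / f 0 !) {{f 0 !≢0}} +_) (go n (f ∘ suc))

M!*[1+M]^M≤eSumScaled*M^M : ∀ M → M ! * (1 + M) ^ M ≤ eSumScaled M * M ^ M
M!*[1+M]^M≤eSumScaled*M^M M = begin
  M ! * (1 + M) ^ M
    ≡⟨ cong (M ! *_) (binomial-theorem M M) ⟩
  M ! * ∑[ j < suc M ] ((M C toℕ j) * M ^ (M ∸ toℕ j))
    ≡⟨ *-distribˡ-∑ (suc M) (M !) (λ j → (M C toℕ j) * M ^ (M ∸ toℕ j)) ⟩
  ∑[ j < suc M ] (M ! * ((M C toℕ j) * M ^ (M ∸ toℕ j)))
    ≤⟨ ∑-mono-≤ (suc M) (λ j → binomial-term-bound (≤-pred (toℕ<n j))) ⟩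
  ∑[ j < suc M ] ((M ! / toℕ j !) {{toℕ j !≢0}} * M ^ M)
    ≡⟨ *-distribʳ-∑ (suc M) (M ^ M) (λ j → (M ! / toℕ j !) {{toℕ j !≢0}}) ⟨
  ∑[ j < suc M ] (M ! / toℕ j !) {{toℕ j !≢0}} * M ^ M
    ≡⟨ cong (_* M ^ M) (eSumScaled≡∑ M) ⟨
  eSumScaled M * M ^ M ∎
  where open ≤-Reasoning

-- A lower bound for the falling factorial

binomial-lower-bound : ∀ M i → M ^ i * (2 * M * M + 2 * i * M + i * i) ≤ 2 * M * M * suc M ^ i + i * M ^ i
binomial-lower-bound M zero =
  ≤-reflexive (solve 1 (λ M → con 1 :* (con 2 :* M :* M :+ con 2 :* con 0 :* M :+ con 0 :* con 0)
                            := con 2 :* M :* M :* con 1 :+ con 0 :* con 1) refl M)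
binomial-lower-bound M (suc i) = +-cancelʳ-≤ (i * suc M * p) _ _ (begin
  M * p * (2 * M * M + 2 * suc i * M + suc i * suc i) + i * suc M * p
    ≤⟨ +-cancelʳ-≤ (p * i) _ _ (begin
         M * p * (2 * M * M + 2 * suc i * M + suc i * suc i) + i * suc M * p + p * i
           ≤⟨ +-monoʳ-≤ _ (*-monoʳ-≤ p (m≤m*m i)) ⟩
         M * p * (2 * M * M + 2 * suc i * M + suc i * suc i) + i * suc M * p + p * (i * i)
           ≡⟨ solve 3 (λ M p i →
                M :* p :* (con 2 :* M :* M :+ con 2 :* (con 1 :+ i) :* M :+ (con 1 :+ i) :* (con 1 :+ i))
                :+ i :* (con 1 :+ M) :* p :+ p :* (i :* i)
                := (con 1 :+ M) :* (p :* (con 2 :* M :* M :+ con 2 :* i :* M :+ i :* i))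
                   :+ (con 1 :+ i) :* (M :* p) :+ p :* i) refl M p i ⟩
         suc M * (p * (2 * M * M + 2 * i * M + i * i)) + suc i * (M * p) + p * i ∎) ⟩
  suc M * (p * (2 * M * M + 2 * i * M + i * i)) + suc i * (M * p)
    ≤⟨ +-monoˡ-≤ _ (*-monoʳ-≤ (suc M) (binomial-lower-bound M i)) ⟩
  suc M * (2 * M * M * q + i * p) + suc i * (M * p)
    ≡⟨ solve 5 (λ M p q i s → (con 1 :+ M) :* (con 2 :* M :* M :* q :+ i :* p) :+ s
                              := con 2 :* M :* M :* ((con 1 :+ M) :* q) :+ s :+ i :* (con 1 :+ M) :* p)
               refl M p q i (suc i * (M * p)) ⟩
  2 * M * M * (suc M * q) + suc i * (M * p) + i * suc M * p ∎)
  where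
  open ≤-Reasoning
  p q : ℕ
  p = M ^ i
  q = suc M ^ i
  m≤m*m : ∀ a → a ≤ a * a
  m≤m*m zero    = z≤n
  m≤m*m (suc a) = m≤m*n (suc a) (suc a)

-- The Weierstrass product inequality (1 − x)(1 − y) ≥ 1 − (x + y), scaled by D².
D*[D∸[x+y]]≤[D∸x]*[D∸y] : ∀ D x y → D * (D ∸ (x + y)) ≤ (D ∸ x) * (D ∸ y)
D*[D∸[x+y]]≤[D∸x]*[D∸y] D x y with x + y ≤? D
... | no x+y≰D = ≤-trans (≤-reflexive (trans (cong (D *_) (m≤n⇒m∸n≡0 (<⇒≤ (≰⇒> x+y≰D)))) (*-zeroʳ D))) z≤n
... | yes x+y≤D with r , refl ← m≤n⇒∃[o]m+o≡n x+y≤D = begin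
  (x + y + r) * (x + y + r ∸ (x + y))
    ≡⟨ cong ((x + y + r) *_) (m+n∸m≡n (x + y) r) ⟩
  (x + y + r) * r
    ≤⟨ m≤n+m _ (y * x) ⟩
  y * x + (x + y + r) * r
    ≡⟨ solve 3 (λ x y r → y :* x :+ (x :+ y :+ r) :* r := (y :+ r) :* (x :+ r)) refl x y r ⟩
  (y + r) * (x + r)
    ≡⟨ cong₂ _*_ (sym (m+n∸m≡n x (y + r))) (sym (m+n∸m≡n y (x + r))) ⟩
  (x + (y + r) ∸ x) * (y + (x + r) ∸ y)
    ≡⟨ cong₂ (λ a b → (a ∸ x) * (b ∸ y)) (sym (+-assoc x y r))
                                         (trans (x+[y+z]≡y+[x+z] y x r) (sym (+-assoc x y r))) ⟩
  (x + y + r ∸ x) * (x + y + r ∸ y)       ∎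
  where open ≤-Reasoning

module ProductEstimate (M : ℕ) where

  D : ℕ
  D = 2 * (M * M * M)

  defect : ℕ → ℕ
  defect i = (i * i + i) * M + i * i * i

  ∑defect : ℕ → ℕ
  ∑defect zero    = 0
  ∑defect (suc k) = ∑defect k + defect k

-- (1 + 1/M)^i (1 − i/M) ≥ 1 − defect i / D, from the first three binomial terms.
factor-bound : ∀ {i M} → i ≤ M → let open ProductEstimate M in
               M ^ suc i * (D ∸ defect i) ≤ suc M ^ i * (M ∸ i) * D
factor-bound {i} {M} i≤M with e , refl ← m≤n⇒∃[o]m+o≡n i≤M = begin
  b * (D ∸ c)             ≡⟨ *-distribˡ-∸ b D c ⟩
  b * D ∸ b * c           ≤⟨ ∸-monoˡ-≤ (b * c) (+-cancelʳ-≤ (i * e * b) _ _ with-slack) ⟩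
  a * D + b * c ∸ b * c   ≡⟨ m+n∸n≡m (a * D) (b * c) ⟩
  a * D                   ∎
  where
  open ProductEstimate M
  open ≤-Reasoning
  p q b c a X : ℕ
  p = M ^ i
  q = suc M ^ i
  b = M * p
  c = defect i
  a = q * (M ∸ i)
  X = 2 * M * M + 2 * i * M + i * i
  with-slack : b * D + i * e * b ≤ a * D + b * c + i * e * b
  with-slack = begin
    b * D + i * e * b
      ≤⟨ m≤m+n _ (b * (i * i)) ⟩
    b * D + i * e * b + b * (i * i)
      ≡⟨ solve 3 (λ i e b → let M = i :+ e in
                   b :* (con 2 :* (M :* M :* M)) :+ i :* e :* b :+ b :* (i :* i)
                   := b :* (e :* (con 2 :* M :* M :+ con 2 :* i :* M :+ i :* i)
                            :+ ((i :* i :+ i) :* M :+ i :* i :* i)))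
                 refl i e b ⟩
    b * (e * X + c)
      ≡⟨ solve 5 (λ M p e X c → M :* p :* (e :* X :+ c) := e :* M :* (p :* X) :+ M :* p :* c) refl M p e X c ⟩
    e * M * (p * X) + b * c
      ≤⟨ +-monoˡ-≤ (b * c) (*-monoʳ-≤ (e * M) (binomial-lower-bound M i)) ⟩
    e * M * (2 * M * M * q + i * p) + b * c
      ≡⟨ solve 6 (λ e M q i p c → e :* M :* (con 2 :* M :* M :* q :+ i :* p) :+ M :* p :* c
                                  := q :* e :* (con 2 :* (M :* M :* M)) :+ M :* p :* c :+ i :* e :* (M :* p))
                 refl e M q i p c ⟩
    q * e * D + b * c + i * e * b
      ≡⟨ cong (λ x → q * x * D + b * c + i * e * b) (m+n∸m≡n i e) ⟨
    a * D + b * c + i * e * b ∎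

triangle : ℕ → ℕ
triangle zero    = 0
triangle (suc k) = triangle k + k

module _ {M : ℕ} where
  open ProductEstimate M

  product-bound : ∀ k → k ≤ M → M ^ (triangle k + k) * (D ∸ ∑defect k) ≤ suc M ^ triangle k * (M P′ k) * D
  product-bound zero    _    = ≤-refl
  product-bound (suc k) k<M = *-cancelˡ-≤ D {{D≢0}} (begin
    D * (M ^ (T + k + suc k) * (D ∸ (S + c)))
      ≡⟨ cong (λ x → D * (x * (D ∸ (S + c)))) (^-distribˡ-+-* M (T + k) (suc k)) ⟩
    D * (Y * b * (D ∸ (S + c)))
      ≡⟨ x*[y*z]≡y*[x*z] D (Y * b) _ ⟩
    Y * b * (D * (D ∸ (S + c)))
      ≤⟨ *-monoʳ-≤ (Y * b) (D*[D∸[x+y]]≤[D∸x]*[D∸y] D S c) ⟩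
    Y * b * ((D ∸ S) * (D ∸ c))
      ≡⟨ *-interchange Y b (D ∸ S) (D ∸ c) ⟩
    Y * (D ∸ S) * (b * (D ∸ c))
      ≤⟨ *-mono-≤ (product-bound k k≤M) (factor-bound k≤M) ⟩
    sMᵀ * P * D * (sMᵏ * (M ∸ k) * D)
      ≡⟨ solve 5 (λ s P D t e → s :* P :* D :* (t :* e :* D) := D :* (s :* t :* (e :* P) :* D))
                 refl sMᵀ P D sMᵏ (M ∸ k) ⟩
    D * (sMᵀ * sMᵏ * ((M ∸ k) * P) * D)
      ≡⟨ cong (λ x → D * (x * ((M ∸ k) * P) * D)) (^-distribˡ-+-* (suc M) T k) ⟨
    D * (suc M ^ (T + k) * ((M ∸ k) * P) * D) ∎)
    where
    open ≤-Reasoning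
    k≤M : k ≤ M
    k≤M = ≤-trans (n≤1+n k) k<M
    T S c Y b P sMᵀ sMᵏ : ℕ
    T = triangle k
    S = ∑defect k
    c = defect k
    Y = M ^ (T + k)
    b = M ^ suc k
    P = M P′ k
    sMᵀ = suc M ^ T
    sMᵏ = suc M ^ k
    1≤M : 1 ≤ M
    1≤M = ≤-trans (s≤s z≤n) k<M
    D≢0 : NonZero D
    D≢0 = >-nonZero (*-mono-≤ {1} {2} (s≤s z≤n) (*-mono-≤ (*-mono-≤ 1≤M 1≤M) 1≤M))

2*triangle+k≡k*k : ∀ k → 2 * triangle k + k ≡ k * k
2*triangle+k≡k*k zero    = refl
2*triangle+k≡k*k (suc k) = begin
  2 * (triangle k + k) + suc k
    ≡⟨ solve 2 (λ t k → con 2 :* (t :+ k) :+ (con 1 :+ k) := (con 2 :* t :+ k) :+ (con 1 :+ k :+ k))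
               refl (triangle k) k ⟩
  2 * triangle k + k + (suc k + k)
    ≡⟨ cong (_+ (suc k + k)) (2*triangle+k≡k*k k) ⟩
  k * k + (suc k + k)
    ≡⟨ solve 1 (λ k → k :* k :+ (con 1 :+ k :+ k) := (con 1 :+ k) :* (con 1 :+ k)) refl k ⟩
  suc k * suc k                     ∎
  where open ≡-Reasoning

∑pronic : ℕ → ℕ
∑pronic zero    = 0
∑pronic (suc k) = ∑pronic k + (k * k + k)

3*∑pronic+k≡k³ : ∀ k → 3 * ∑pronic k + k ≡ k * k * k
3*∑pronic+k≡k³ zero    = refl
3*∑pronic+k≡k³ (suc k) = begin
  3 * (∑pronic k + (k * k + k)) + suc k
    ≡⟨ solve 2 (λ s k → con 3 :* (s :+ (k :* k :+ k)) :+ (con 1 :+ k)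
        := (con 3 :* s :+ k) :+ (con 3 :* (k :* k :+ k) :+ con 1)) refl (∑pronic k) k ⟩
  3 * ∑pronic k + k + (3 * (k * k + k) + 1)
    ≡⟨ cong (_+ (3 * (k * k + k) + 1)) (3*∑pronic+k≡k³ k) ⟩
  k * k * k + (3 * (k * k + k) + 1)
    ≡⟨ solve 1 (λ k → k :* k :* k :+ (con 3 :* (k :* k :+ k) :+ con 1)
        := (con 1 :+ k) :* (con 1 :+ k) :* (con 1 :+ k)) refl k ⟩
  suc k * suc k * suc k                          ∎
  where open ≡-Reasoning

∑defect≡ : ∀ M k → ProductEstimate.∑defect M k ≡ M * ∑pronic k + triangle k * triangle k
∑defect≡ M zero    = solve 1 (λ M → con 0 := M :* con 0 :+ con 0) refl M
∑defect≡ M (suc k) = begin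
  ∑defect k + ((k * k + k) * M + k * k * k)
    ≡⟨ cong (_+ ((k * k + k) * M + k * k * k)) (∑defect≡ M k) ⟩
  M * ∑pronic k + t * t + ((k * k + k) * M + k * k * k)
    ≡⟨ cong (λ x → M * ∑pronic k + t * t + ((k * k + k) * M + x * k)) (2*triangle+k≡k*k k) ⟨
  M * ∑pronic k + t * t + ((k * k + k) * M + (2 * t + k) * k)
    ≡⟨ solve 4 (λ M s t k → M :* s :+ t :* t :+ ((k :* k :+ k) :* M :+ (con 2 :* t :+ k) :* k)
                          := M :* (s :+ (k :* k :+ k)) :+ (t :+ k) :* (t :+ k)) refl M (∑pronic k) t k ⟩
  M * (∑pronic k + (k * k + k)) + (t + k) * (t + k) ∎
  where
  open ≡-Reasoning
  open ProductEstimate M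
  t : ℕ
  t = triangle k

-- With k = 9 + j, 2M = k(k − 1) and 3s = (k + 1)k(k − 1), the difference
-- 48M³ − 24k(Ms + M²) is the positive polynomial slack below.
k*[M*s+M*M]<2*M³ : ∀ j M s → 2 * M ≡ (9 + j) * (8 + j) → 3 * s ≡ (10 + j) * (9 + j) * (8 + j) →
                   (9 + j) * (M * s + M * M) < 2 * (M * M * M)
k*[M*s+M*M]<2*M³ j M s 2M≡ 3s≡ = *-cancelˡ-< 24 _ _ (begin-strict
  24 * (k * (M * s + M * M))
    <⟨ m<m+n _ {slack} (s≤s z≤n) ⟩
  24 * (k * (M * s + M * M)) + slack
    ≡⟨ cong (_+ slack) (solve 3 (λ k M s → con 24 :* (k :* (M :* s :+ M :* M))
                                           := con 4 :* k :* (con 2 :* M) :* (con 3 :* s)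
                                              :+ con 6 :* k :* (con 2 :* M) :* (con 2 :* M))
                                refl k M s) ⟩
  4 * k * (2 * M) * (3 * s) + 6 * k * (2 * M) * (2 * M) + slack
    ≡⟨ cong₂ (λ x y → 4 * k * x * y + 6 * k * x * x + slack) 2M≡ 3s≡ ⟩
  4 * k * P * A + 6 * k * P * P + slack
    ≡⟨ solve 1 (λ j → let k = con 9 :+ j; P = k :* (con 8 :+ j); A = (con 10 :+ j) :* k :* (con 8 :+ j) in
                 con 4 :* k :* P :* A :+ con 6 :* k :* P :* P
                 :+ con 2 :* P :* (k :* k :* (con 8 :+ j) :* (con 1 :+ j))
                 := con 6 :* P :* P :* P) refl j ⟩
  6 * P * P * P
    ≡⟨ cong (λ x → 6 * x * x * x) 2M≡ ⟨
  6 * (2 * M) * (2 * M) * (2 * M)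
    ≡⟨ solve 1 (λ M → con 6 :* (con 2 :* M) :* (con 2 :* M) :* (con 2 :* M) := con 24 :* (con 2 :* (M :* M :* M)))
               refl M ⟩
  24 * (2 * (M * M * M)) ∎)
  where
  open ≤-Reasoning
  k P A slack : ℕ
  k = 9 + j
  P = (9 + j) * (8 + j)
  A = (10 + j) * (9 + j) * (8 + j)
  slack = 2 * P * ((9 + j) * (9 + j) * (8 + j) * (1 + j))

-- M = k(k − 1)/2 minimises 2M · exp (k(k − 1)/2M), the leading approximation of
-- 2M · M^k / (M P′ k), with minimum k(k − 1)e < k²e.
module LargeK (j : ℕ) where

  k M : ℕ
  k = 9 + j
  M = triangle k

  open ProductEstimate M

  2*M≡[9+j]*[8+j] : 2 * M ≡ (9 + j) * (8 + j)
  2*M≡[9+j]*[8+j] = +-cancelʳ-≡ k _ _ (trans (2*triangle+k≡k*k k)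
    (solve 1 (λ j → let k = con 9 :+ j in k :* k := k :* (con 8 :+ j) :+ k) refl j))

  3*∑pronic≡[10+j]*[9+j]*[8+j] : 3 * ∑pronic k ≡ (10 + j) * (9 + j) * (8 + j)
  3*∑pronic≡[10+j]*[9+j]*[8+j] = +-cancelʳ-≡ k _ _ (trans (3*∑pronic+k≡k³ k)
    (solve 1 (λ j → let k = con 9 :+ j in k :* k :* k := (con 10 :+ j) :* k :* (con 8 :+ j) :+ k) refl j))

  k*∑defect<D : k * ∑defect k < D
  k*∑defect<D = subst (λ s → k * s < D) (sym (∑defect≡ M k))
    (k*[M*s+M*M]<2*M³ j M (∑pronic k) 2*M≡[9+j]*[8+j] 3*∑pronic≡[10+j]*[9+j]*[8+j])

  k≤M : k ≤ M
  k≤M = *-cancelˡ-≤ 2 (begin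
    2 * k          ≤⟨ *-monoˡ-≤ k {2} {8 + j} (s≤s (s≤s z≤n)) ⟩
    (8 + j) * k    ≡⟨ *-comm (8 + j) k ⟩
    k * (8 + j)    ≡⟨ 2*M≡[9+j]*[8+j] ⟨
    2 * M          ∎)
    where open ≤-Reasoning

  instance
    M≢0 : NonZero M
    M≢0 = >-nonZero (≤-trans (s≤s z≤n) k≤M)

  [k∸1]*M^[M+k]<k*[1+M]^M*MP′k : (k ∸ 1) * M ^ (M + k) < k * (suc M ^ M * (M P′ k))
  [k∸1]*M^[M+k]<k*[1+M]^M*MP′k = *-cancelʳ-< D _ _ (begin-strict
    (k ∸ 1) * Y * D
      ≡⟨ x*y*z≡y*[x*z] (k ∸ 1) Y D ⟩
    Y * ((k ∸ 1) * D)
      ≡⟨ cong (Y *_) (trans (*-distribʳ-∸ D k 1) (cong (k * D ∸_) (*-identityˡ D))) ⟩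
    Y * (k * D ∸ D)
      <⟨ *-monoʳ-< Y {{m^n≢0 M (M + k)}} (∸-monoʳ-< k*∑defect<D (m≤n*m D k)) ⟩
    Y * (k * D ∸ k * ∑defect k)
      ≡⟨ cong (Y *_) (*-distribˡ-∸ k D (∑defect k)) ⟨
    Y * (k * (D ∸ ∑defect k))
      ≡⟨ x*[y*z]≡y*[x*z] Y k _ ⟩
    k * (Y * (D ∸ ∑defect k))
      ≤⟨ *-monoʳ-≤ k (product-bound k k≤M) ⟩
    k * (suc M ^ M * (M P′ k) * D)
      ≡⟨ *-assoc k (suc M ^ M * (M P′ k)) D ⟨
    k * (suc M ^ M * (M P′ k)) * D ∎)
    where
    open ≤-Reasoning
    Y : ℕ
    Y = M ^ (M + k)

  certificate : 2 * M * M ^ k * M ! < k * k * (M P′ k) * eSumScaled M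
  certificate = *-cancelʳ-< (M ^ M) _ _ (begin-strict
    2 * M * M ^ k * M ! * M ^ M
      ≡⟨ cong (λ x → x * M ^ k * M ! * M ^ M) (trans 2*M≡[9+j]*[8+j] (*-comm (9 + j) (8 + j))) ⟩
    (k ∸ 1) * k * M ^ k * M ! * M ^ M
      ≡⟨ solve 5 (λ a k b f c → a :* k :* b :* f :* c := k :* f :* (a :* (c :* b)))
                 refl (k ∸ 1) k (M ^ k) (M !) (M ^ M) ⟩
    k * M ! * ((k ∸ 1) * (M ^ M * M ^ k))
      ≡⟨ cong (λ x → k * M ! * ((k ∸ 1) * x)) (^-distribˡ-+-* M M k) ⟨
    k * M ! * ((k ∸ 1) * M ^ (M + k))
      <⟨ *-monoʳ-< (k * M !) {{m*n≢0 k (M !) {{_}} {{M !≢0}}}} [k∸1]*M^[M+k]<k*[1+M]^M*MP′k ⟩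
    k * M ! * (k * (suc M ^ M * P))
      ≡⟨ solve 4 (λ k f s P → k :* f :* (k :* (s :* P)) := k :* k :* P :* (f :* s)) refl k (M !) (suc M ^ M) P ⟩
    k * k * P * (M ! * suc M ^ M)
      ≤⟨ *-monoʳ-≤ (k * k * P) (M!*[1+M]^M≤eSumScaled*M^M M) ⟩
    k * k * P * (eSumScaled M * M ^ M)
      ≡⟨ *-assoc (k * k * P) (eSumScaled M) (M ^ M) ⟨
    k * k * P * eSumScaled M * M ^ M ∎)
    where
    open ≤-Reasoning
    P : ℕ
    P = M P′ k

-- Choice of parameters

Certificate : ℕ → ℕ → ℕ → Set
Certificate k m T = 2 * m * m ^ k * T ! < k * k * (m P′ k) * eSumScaled T

certificate : ∀ k → 2 ≤ k → Σ ℕ λ m → NonZero m × Σ ℕ (Certificate k m)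
certificate 1 (s≤s ())
certificate 2 _ = 2  , _ , 2 , toWitness {a? = _ <? _} _
certificate 3 _ = 4  , _ , 2 , toWitness {a? = _ <? _} _
certificate 4 _ = 8  , _ , 2 , toWitness {a? = _ <? _} _
certificate 5 _ = 10 , _ , 3 , toWitness {a? = _ <? _} _
certificate 6 _ = 15 , _ , 3 , toWitness {a? = _ <? _} _
certificate 7 _ = 21 , _ , 3 , toWitness {a? = _ <? _} _
certificate 8 _ = 27 , _ , 3 , toWitness {a? = _ <? _} _
certificate (suc (suc (suc (suc (suc (suc (suc (suc (suc j))))))))) _ =
  LargeK.M j , LargeK.M≢0 j , LargeK.M j , LargeK.certificate j

mainTheorem4 : (k n : ℕ) → 2 ≤ k → 1 ≤ n →
    Σ (Strategy n (n + k)) λ s → SuccessAtLeastOneOverEK² n k s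
mainTheorem4 k n 2≤k@(s≤s (s≤s _)) _ with certificate k 2≤k
... | m , m≢0 , T , bound = Averaging.success n k m {{m≢0}} (n Fin.↑ʳ zero) T bound
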